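{- Let $m\geqslant 3$, $n\geqslant 3$ be odd integers, $m=2m_0+1$, $n=2n_0+1$, $m_0^{+}=m_0+1$, $n_0^{+}=n_0+1$. Let $X$ be a bicentrally balanced $C_4$-face-magic projective labeling on $\mathcal{P}_{m,n}$. Then there is a unique bicentrally balanced $C_4$-face-magic projective labeling $Z=\{z_{i,j}\}$ on $\mathcal{P}_{m,n}$ that is projective labeling equivalent to $X$ such that: $z_{i,n_0^{+}}<z_{i+2,n_0^{+}}$ for all $1\leqslant i\leqslant m-2$ with $i+n_0^{+}$ even; $z_{i,n_0^{+}}>z_{i+2,n_0^{+}}$ for all $1\leqslant i\leqslant m-2$ with $i+n_0^{+}$ odd; $z_{m_0^{+},j}<z_{m_0^{+},j+2}$ for all $1\leqslant j\leqslant n-2$ with $m_0^{+}+j$ even; and $z_{m_0^{+},j}>z_{m_0^{+},j+2}$ for all $1\leqslant j\leqslant n-2$ with $m_0^{+}+j$ odd.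
   Context: For integers $m,n\geqslant 2$, the projective grid graph $\mathcal{P}_{m,n}$ has vertex set $\{(i,j):1\leqslant i\leqslant m,\ 1\leqslant j\leqslant n\}$ and edges $(i,j)$–$(i,j+1)$ ($j\leqslant n-1$), $(i,n)$–$(m+1-i,1)$, $(i,j)$–$(i+1,j)$ ($i\leqslant m-1$), $(m,j)$–$(1,n+1-j)$, embedded naturally in the projective plane. Its 4-cycle faces are $\{(i,j),(i+1,j),(i,j+1),(i+1,j+1)\}$ ($1\leqslant i\leqslant m-1$, $1\leqslant j\leqslant n-1$), $\{(i,n),(i+1,n),(m+1-i,1),(m-i,1)\}$ ($1\leqslant i\leqslant m-1$), and $\{(m,j),(m,j+1),(1,n+1-j),(1,n-j)\}$ ($1\leqslant j\leqslant n-1$); the other two faces are digons. A $C_4$-face-magic projective labeling is a bijection $(i,j)\mapsto x_{i,j}$ onto $\{1,\ldots,mn\}$ such that every 4-cycle face has the same label sum (the $C_4$-face-magic value). For odd $m,n$ let $S(i,j)=\tfrac12 mn+\tfrac32$ if $i+j$ is even and $\tfrac32 mn+\tfrac32$ if $i+j$ is odd; a $C_4$-face-magic projective labeling with value $2mn+3$ is bicentrally balanced if $x_{i,j}+x_{m+1-i,n+1-j}=S(i,j)$ for all $(i,j)$. Elementary projective labeling operations on a bicentrally balanced labeling $X=\{x_{i,j}\}$ (each producing $Z=\{z_{i,j}\}$) are: (a) for a permutation $\eta$ of $\{1,\ldots,m_0\}$ with $\eta(i)\equiv i\pmod 2$: $z_{i,j}=x_{\eta(i),j}$, $z_{m_0^{+},j}=x_{m_0^{+},j}$,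 $z_{m+1-i,j}=x_{m+1-\eta(i),j}$ ($1\leqslant i\leqslant m_0$, $1\leqslant j\leqslant n$); (b) for a permutation $\kappa$ of $\{1,\ldots,n_0\}$ with $\kappa(j)\equiv j\pmod 2$: $z_{i,j}=x_{i,\kappa(j)}$, $z_{i,n_0^{+}}=x_{i,n_0^{+}}$, $z_{i,n+1-j}=x_{i,n+1-\kappa(j)}$ ($1\leqslant i\leqslant m$, $1\leqslant j\leqslant n_0$); (c) for $\alpha:\{1,\ldots,m_0\}\to\{0,1\}$: swap the labels of column $i$ (vertices $(i,\cdot)$) with those of column $m+1-i$ exactly when $\alpha(i)=1$, other labels unchanged; (d) for $\delta:\{1,\ldots,n_0\}\to\{0,1\}$: swap the labels of row $j$ (vertices $(\cdot,j)$) with those of row $n+1-j$ exactly when $\delta(j)=1$, other labels unchanged. Each such operation sends bicentrally balanced $C_4$-face-magic projective labelings to bicentrally balanced $C_4$-face-magic projective labelings. Two bicentrally balanced $C_4$-face-magic projective labelings are projective labeling equivalent if one can be obtained from the other by a finite sequence of elementary projective labeling operations. -}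

module Defs where

open import Data.Nat using (ℕ; suc; _+_; _*_; _∸_; _≤_; _<_; _>_; _%_)
open import Data.Bool using (Bool; true; false)
open import Data.Product using (Σ; ∃; _×_)
open import Data.Sum using (_⊎_)
open import Relation.Binary.PropositionalEquality using (_≡_)
open import Relation.Binary.Construct.Closure.ReflexiveTransitive using (Star)

-- Labelings are 1-indexed functions ℕ → ℕ → ℕ; only the values at grid
-- points (i , j) with 1 ≤ i ≤ m, 1 ≤ j ≤ n are meaningful.
Lab : Set
Lab = ℕ → ℕ → ℕ

IsEven : ℕ → Set
IsEven k = k % 2 ≡ 0

IsOdd : ℕ → Set
IsOdd k = k % 2 ≡ 1

module Grid (m0 n0 : ℕ) where

  m : ℕ
  m = 2 * m0 + 1

  n : ℕ
  n = 2 * n0 + 1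

  InGrid : ℕ → ℕ → Set
  InGrid i j = (1 ≤ i × i ≤ m) × (1 ≤ j × j ≤ n)

  IsLabeling : Lab → Set
  IsLabeling x =
    (∀ i j → InGrid i j → 1 ≤ x i j × x i j ≤ m * n)
    × (∀ i j i' j' → InGrid i j → InGrid i' j' → x i j ≡ x i' j' → i ≡ i' × j ≡ j')
    × (∀ k → 1 ≤ k → k ≤ m * n → Σ ℕ λ i → Σ ℕ λ j → InGrid i j × x i j ≡ k)

  FaceMagic : ℕ → Lab → Set
  FaceMagic c x =
    (∀ i j → 1 ≤ i → i ≤ m ∸ 1 → 1 ≤ j → j ≤ n ∸ 1 →
       x i j + x (i + 1) j + x i (j + 1) + x (i + 1) (j + 1) ≡ c)
    × (∀ i → 1 ≤ i → i ≤ m ∸ 1 →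
       x i n + x (i + 1) n + x (m + 1 ∸ i) 1 + x (m ∸ i) 1 ≡ c)
    × (∀ j → 1 ≤ j → j ≤ n ∸ 1 →
       x m j + x m (j + 1) + x 1 (n + 1 ∸ j) + x 1 (n ∸ j) ≡ c)

  -- x_{i,j} + x_{m+1-i,n+1-j} = S(i,j), written doubled (2 S(i,j) ∈ {mn+3, 3mn+3})
  Balanced : Lab → Set
  Balanced x = ∀ i j → InGrid i j →
    (IsEven (i + j) → 2 * (x i j + x (m + 1 ∸ i) (n + 1 ∸ j)) ≡ m * n + 3)
    × (IsOdd (i + j) → 2 * (x i j + x (m + 1 ∸ i) (n + 1 ∸ j)) ≡ 3 * (m * n) + 3)

  BicBal : Lab → Set
  BicBal x = IsLabeling x × FaceMagic (2 * (m * n) + 3) x × Balanced x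

  ParityPerm : ℕ → (ℕ → ℕ) → Set
  ParityPerm k η =
    (∀ i → 1 ≤ i → i ≤ k → 1 ≤ η i × η i ≤ k)
    × (∀ i i' → 1 ≤ i → i ≤ k → 1 ≤ i' → i' ≤ k → η i ≡ η i' → i ≡ i')
    × (∀ i' → 1 ≤ i' → i' ≤ k → Σ ℕ λ i → (1 ≤ i × i ≤ k) × η i ≡ i')
    × (∀ i → 1 ≤ i → i ≤ k → η i % 2 ≡ i % 2)

  OpA : Lab → Lab → Set
  OpA x z = Σ (ℕ → ℕ) λ η → ParityPerm m0 η
    × (∀ i j → 1 ≤ i → i ≤ m0 → 1 ≤ j → j ≤ n →
         z i j ≡ x (η i) j × z (m + 1 ∸ i) j ≡ x (m + 1 ∸ η i) j)
    × (∀ j → 1 ≤ j → j ≤ n → z (suc m0) j ≡ x (suc m0) j)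

  OpB : Lab → Lab → Set
  OpB x z = Σ (ℕ → ℕ) λ κ → ParityPerm n0 κ
    × (∀ i j → 1 ≤ i → i ≤ m → 1 ≤ j → j ≤ n0 →
         z i j ≡ x i (κ j) × z i (n + 1 ∸ j) ≡ x i (n + 1 ∸ κ j))
    × (∀ i → 1 ≤ i → i ≤ m → z i (suc n0) ≡ x i (suc n0))

  OpC : Lab → Lab → Set
  OpC x z = Σ (ℕ → Bool) λ α →
    (∀ i j → 1 ≤ i → i ≤ m0 → 1 ≤ j → j ≤ n →
       (α i ≡ true → z i j ≡ x (m + 1 ∸ i) j × z (m + 1 ∸ i) j ≡ x i j)
       × (α i ≡ false → z i j ≡ x i j × z (m + 1 ∸ i) j ≡ x (m + 1 ∸ i) j))
    × (∀ j → 1 ≤ j → j ≤ n → z (suc m0) j ≡ x (suc m0) j)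

  OpD : Lab → Lab → Set
  OpD x z = Σ (ℕ → Bool) λ δ →
    (∀ i j → 1 ≤ i → i ≤ m → 1 ≤ j → j ≤ n0 →
       (δ j ≡ true → z i j ≡ x i (n + 1 ∸ j) × z i (n + 1 ∸ j) ≡ x i j)
       × (δ j ≡ false → z i j ≡ x i j × z i (n + 1 ∸ j) ≡ x i (n + 1 ∸ j)))
    × (∀ i → 1 ≤ i → i ≤ m → z i (suc n0) ≡ x i (suc n0))

  Step : Lab → Lab → Set
  Step x z = BicBal x × (OpA x z ⊎ OpB x z ⊎ OpC x z ⊎ OpD x z)

  Equiv : Lab → Lab → Set
  Equiv x z = Star Step x z ⊎ Star Step z x

  Normal : Lab → Set
  Normal z =
    (∀ i → 1 ≤ i → i ≤ m ∸ 2 → IsEven (i + suc n0) → z i (suc n0) < z (i + 2) (suc n0))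
    × (∀ i → 1 ≤ i → i ≤ m ∸ 2 → IsOdd (i + suc n0) → z i (suc n0) > z (i + 2) (suc n0))
    × (∀ j → 1 ≤ j → j ≤ n ∸ 2 → IsEven (suc m0 + j) → z (suc m0) j < z (suc m0) (j + 2))
    × (∀ j → 1 ≤ j → j ≤ n ∸ 2 → IsOdd (suc m0 + j) → z (suc m0) j > z (suc m0) (j + 2))

-- Every elementary operation replaces a labeling X by (i , j) ↦ X (σ i) (τ j), where σ and τ are
-- parity-preserving permutations commuting with the reflections i ↦ m + 1 - i, j ↦ n + 1 - j; such
-- rearrangements compose and preserve bicentral balance (twisted faces are sums of two opposite
-- pairs, and face-magic forces X a b + X a' b + X a b' + X a' b' to be the magic value whenever
-- a - a' and b - b' are odd). Since τ fixes the centre, the middle row of a rearrangement is the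
-- middle row of X permuted by σ, and the normal-form conditions say that it is monotone on each
-- parity class, in a prescribed direction; an injective sequence admits only one such sorting
-- permutation, so σ, and likewise τ, is unique. For existence, operation (c) orients every mirror
-- pair of the middle row and operation (a) sorts its lower half; balance makes the sum of a mirror
-- pair depend only on its parity class, which sorts the upper half as well. Operations (d) and (b)
-- then do the same for the middle column without moving the middle row.

module Submission where

open import Defs
open import Data.Nat hiding (parity)
open import Data.Nat.Properties
open import Data.Nat.DivMod
open import Data.Nat.Induction using (<-rec)
open import Data.Product using (Σ; _×_; _,_; proj₁; proj₂)
open import Data.Sum using (_⊎_; inj₁; inj₂)
open import Data.Empty using (⊥; ⊥-elim)
open import Data.Bool using (Bool; true; false; not)
open import Relation.Nullary using (Dec; does; yes; no)
open import Relation.Binary.Definitions using (tri<; tri≈; tri>)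
open import Relation.Binary.PropositionalEquality
open import Relation.Binary.Construct.Closure.ReflexiveTransitive using (Star; ε; _◅_)
open import Data.Nat.Solver using (module +-*-Solver)
open +-*-Solver using (solve; _:+_; _:*_; _:=_; con)

-- Parity arithmetic

%2-cases : ∀ a → a % 2 ≡ 0 ⊎ a % 2 ≡ 1
%2-cases zero = inj₁ refl
%2-cases (suc zero) = inj₂ refl
%2-cases (suc (suc a)) = %2-cases a

suc-%2≢ : ∀ a → suc a % 2 ≢ a % 2
suc-%2≢ zero ()
suc-%2≢ (suc zero) ()
suc-%2≢ (suc (suc a)) = suc-%2≢ a

+-%2-cong : ∀ a b a' b' → a % 2 ≡ a' % 2 → b % 2 ≡ b' % 2 → (a + b) % 2 ≡ (a' + b') % 2
+-%2-cong a b a' b' p q = begin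
  (a + b) % 2               ≡⟨ %-distribˡ-+ a b 2 ⟩
  (a % 2 + b % 2) % 2       ≡⟨ cong₂ (λ x y → (x + y) % 2) p q ⟩
  (a' % 2 + b' % 2) % 2     ≡⟨ %-distribˡ-+ a' b' 2 ⟨
  (a' + b') % 2             ∎
  where open ≡-Reasoning

even-+⇒%2≡ : ∀ a b → (a + b) % 2 ≡ 0 → a % 2 ≡ b % 2
even-+⇒%2≡ zero b h = sym h
even-+⇒%2≡ (suc zero) zero ()
even-+⇒%2≡ (suc zero) (suc zero) h = refl
even-+⇒%2≡ (suc zero) (suc (suc b)) h = even-+⇒%2≡ 1 b h
even-+⇒%2≡ (suc (suc a)) b h = even-+⇒%2≡ a b h

odd-+-cases : ∀ a b → (a + b) % 2 ≡ 1 → (a % 2 ≡ 0 × b % 2 ≡ 1) ⊎ (a % 2 ≡ 1 × b % 2 ≡ 0)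
odd-+-cases a b odd with %2-cases a | %2-cases b
... | inj₁ a0 | inj₁ b0 = ⊥-elim (0≢1+n (trans (sym (+-%2-cong a b 0 0 a0 b0)) odd))
... | inj₁ a0 | inj₂ b1 = inj₁ (a0 , b1)
... | inj₂ a1 | inj₁ b0 = inj₂ (a1 , b0)
... | inj₂ a1 | inj₂ b1 = ⊥-elim (0≢1+n (trans (sym (+-%2-cong a b 1 1 a1 b1)) odd))

odd-witness : ∀ {x} k → x ≡ 1 + k * 2 → x % 2 ≡ 1
odd-witness k refl = [m+kn]%n≡m%n 1 k 2

+-+1-odd : ∀ x → (x + (x + 1)) % 2 ≡ 1
+-+1-odd x = odd-witness x (solve 1 (λ x → x :+ (x :+ con 1) := con 1 :+ x :* con 2) refl x)

x+x≡y+y⇒x≡y : ∀ x y → x + x ≡ y + y → x ≡ y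
x+x≡y+y⇒x≡y x y e with <-cmp x y
... | tri< x<y _ _ = ⊥-elim (<⇒≢ (+-mono-< x<y x<y) e)
... | tri≈ _ x≡y _ = x≡y
... | tri> _ _ y<x = ⊥-elim (<⇒≢ (+-mono-< y<x y<x) (sym e))

x+x-even : ∀ x → (x + x) % 2 ≡ 0
x+x-even zero = refl
x+x-even (suc x) = trans (cong (λ z → suc z % 2) (+-suc x x)) (x+x-even x)

x+x<y+y⇒x<y : ∀ {x y} → x + x < y + y → x < y
x+x<y+y⇒x<y {x} {y} lt with <-cmp x y
... | tri< x<y _ _ = x<y
... | tri≈ _ refl _ = ⊥-elim (<-irrefl refl lt)
... | tri> _ _ y<x = ⊥-elim (<-asym lt (+-mono-< y<x y<x))

module _ {f : ℕ → ℕ} {C N : ℕ} (consecutive : ∀ k → 1 ≤ k → k + 1 ≤ N → f k + f (k + 1) ≡ C) where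

  private
    f-2+ : ∀ k → 1 ≤ k → 2 + k ≤ N → f (2 + k) ≡ f k
    f-2+ k p le = +-cancelˡ-≡ (f (k + 1)) _ _ (begin
      f (k + 1) + f (2 + k)        ≡⟨ cong (λ z → f (k + 1) + f z) 2+k≡k+1+1 ⟩
      f (k + 1) + f (k + 1 + 1)    ≡⟨ consecutive (k + 1) (≤-trans p (m≤m+n k 1)) (≤-trans (≤-reflexive (sym 2+k≡k+1+1)) le) ⟩
      C                            ≡⟨ consecutive k p (≤-trans (≤-reflexive (+-comm k 1)) (≤-trans (n≤1+n _) le)) ⟨
      f k + f (k + 1)              ≡⟨ +-comm (f k) (f (k + 1)) ⟩
      f (k + 1) + f k              ∎)
      where
      open ≡-Reasoning
      2+k≡k+1+1 : 2 + k ≡ k + 1 + 1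
      2+k≡k+1+1 = solve 1 (λ k → con 2 :+ k := k :+ con 1 :+ con 1) refl k

    f-odd : ∀ a → a ≤ N → a % 2 ≡ 1 → f a ≡ f 1
    f-odd (suc zero) _ _ = refl
    f-odd (suc (suc (suc a))) le pa =
      trans (f-2+ (suc a) (s≤s z≤n) le) (f-odd (suc a) (≤-trans (m≤n+m (suc a) 2) le) pa)

    f-even : ∀ a → 1 ≤ a → a ≤ N → a % 2 ≡ 0 → f a ≡ f 2
    f-even (suc (suc zero)) _ _ _ = refl
    f-even (suc (suc (suc (suc a)))) _ le pa =
      trans (f-2+ (2 + a) (s≤s z≤n) le) (f-even (suc (suc a)) (s≤s z≤n) (≤-trans (m≤n+m (2 + a) 2) le) pa)

    2≤even : ∀ a → 1 ≤ a → a ≤ N → a % 2 ≡ 0 → 2 ≤ N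
    2≤even (suc (suc a)) _ le _ = ≤-trans (s≤s (s≤s z≤n)) le

  -- f is 2-periodic on [1, N], so f a + f a' = f 1 + f 2 whenever a, a' have different parities.
  odd-distance-sum : ∀ a a' → 1 ≤ a → a ≤ N → 1 ≤ a' → a' ≤ N → (a + a') % 2 ≡ 1 → f a + f a' ≡ C
  odd-distance-sum a a' pa qa pa' qa' odd with odd-+-cases a a' odd
  ... | inj₁ (a0 , a'1) = trans (cong₂ _+_ (f-even a pa qa a0) (f-odd a' qa' a'1))
                                (trans (+-comm (f 2) (f 1)) (consecutive 1 ≤-refl (2≤even a pa qa a0)))
  ... | inj₂ (a1 , a'0) = trans (cong₂ _+_ (f-odd a qa a1) (f-even a' pa' qa' a'0))
                                (consecutive 1 ≤-refl (2≤even a' pa' qa' a'0))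

-- Parity-preserving permutations

-- Grid.ParityPerm does not depend on the grid dimensions.
ParityPerm : ℕ → (ℕ → ℕ) → Set
ParityPerm = Grid.ParityPerm 0 0

module _ {k : ℕ} {η : ℕ → ℕ} (p : ParityPerm k η) where

  parityPerm-range : ∀ i → 1 ≤ i → i ≤ k → 1 ≤ η i × η i ≤ k
  parityPerm-range = proj₁ p

  parityPerm-injective : ∀ i i' → 1 ≤ i → i ≤ k → 1 ≤ i' → i' ≤ k → η i ≡ η i' → i ≡ i'
  parityPerm-injective = proj₁ (proj₂ p)

  parityPerm-surjective : ∀ i' → 1 ≤ i' → i' ≤ k → Σ ℕ λ i → (1 ≤ i × i ≤ k) × η i ≡ i'
  parityPerm-surjective = proj₁ (proj₂ (proj₂ p))

  parityPerm-parity : ∀ i → 1 ≤ i → i ≤ k → η i % 2 ≡ i % 2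
  parityPerm-parity = proj₂ (proj₂ (proj₂ p))

parityPerm-id : ∀ k → ParityPerm k (λ i → i)
parityPerm-id k = (λ _ p q → p , q) , (λ _ _ _ _ _ _ e → e) , (λ i' p q → i' , (p , q) , refl) , (λ _ _ _ → refl)

parityPerm-∘ : ∀ {k f g} → ParityPerm k f → ParityPerm k g → ParityPerm k (λ i → f (g i))
parityPerm-∘ {k} {f} {g} pf pg = range , injective , surjective , same-parity
  where
  g-range = parityPerm-range pg
  range : ∀ i → 1 ≤ i → i ≤ k → 1 ≤ f (g i) × f (g i) ≤ k
  range i p q = let (p' , q') = g-range i p q in parityPerm-range pf (g i) p' q'
  injective : ∀ i i' → 1 ≤ i → i ≤ k → 1 ≤ i' → i' ≤ k → f (g i) ≡ f (g i') → i ≡ i'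
  injective i i' p q p' q' e =
    let (gp , gq) = g-range i p q ; (gp' , gq') = g-range i' p' q' in
    parityPerm-injective pg i i' p q p' q' (parityPerm-injective pf (g i) (g i') gp gq gp' gq' e)
  surjective : ∀ i' → 1 ≤ i' → i' ≤ k → Σ ℕ λ i → (1 ≤ i × i ≤ k) × f (g i) ≡ i'
  surjective i' p q =
    let (a , (pa , qa) , ea) = parityPerm-surjective pf i' p q
        (b , bk , eb) = parityPerm-surjective pg a pa qa
    in b , bk , trans (cong f eb) ea
  same-parity : ∀ i → 1 ≤ i → i ≤ k → f (g i) % 2 ≡ i % 2
  same-parity i p q = let (gp , gq) = g-range i p q in
    trans (parityPerm-parity pf (g i) gp gq) (parityPerm-parity pg i p q)

transpose : ℕ → ℕ → ℕ → ℕ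
transpose a b i with i ≟ a
... | yes _ = b
... | no _ with i ≟ b
...   | yes _ = a
...   | no _  = i

data TransposeView (a b i : ℕ) : ℕ → Set where
  at-a  : i ≡ a → TransposeView a b i b
  at-b  : i ≡ b → TransposeView a b i a
  other : i ≢ a → i ≢ b → TransposeView a b i i

transpose-view : ∀ a b i → TransposeView a b i (transpose a b i)
transpose-view a b i with i ≟ a
... | yes e = at-a e
... | no i≢a with i ≟ b
...   | yes e  = at-b e
...   | no i≢b = other i≢a i≢b

transpose-left : ∀ a b → transpose a b a ≡ b
transpose-left a b with transpose a b a | transpose-view a b a
... | _ | at-a _ = refl
... | _ | at-b e = e
... | _ | other a≢a _ = ⊥-elim (a≢a refl)

transpose-right : ∀ a b → transpose a b b ≡ a
transpose-right a b with transpose a b b | transpose-view a b b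
... | _ | at-a e = e
... | _ | at-b _ = refl
... | _ | other _ b≢b = ⊥-elim (b≢b refl)

transpose-involutive : ∀ a b i → transpose a b (transpose a b i) ≡ i
transpose-involutive a b i with transpose a b i | transpose-view a b i
... | _ | at-a refl = transpose-right a b
... | _ | at-b refl = transpose-left a b
... | _ | other i≢a i≢b with transpose a b i | transpose-view a b i
...   | _ | at-a e = ⊥-elim (i≢a e)
...   | _ | at-b e = ⊥-elim (i≢b e)
...   | _ | other _ _ = refl

parityPerm-transpose : ∀ {k a b} → 1 ≤ a → a ≤ k → 1 ≤ b → b ≤ k → a % 2 ≡ b % 2 → ParityPerm k (transpose a b)
parityPerm-transpose {k} {a} {b} pa qa pb qb ab = range , injective , surjective , same-parity
  where
  range : ∀ i → 1 ≤ i → i ≤ k → 1 ≤ transpose a b i × transpose a b i ≤ k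
  range i p q with transpose a b i | transpose-view a b i
  ... | _ | at-a _ = pb , qb
  ... | _ | at-b _ = pa , qa
  ... | _ | other _ _ = p , q
  injective : ∀ i i' → 1 ≤ i → i ≤ k → 1 ≤ i' → i' ≤ k → transpose a b i ≡ transpose a b i' → i ≡ i'
  injective i i' _ _ _ _ e = begin
    i                                   ≡⟨ transpose-involutive a b i ⟨
    transpose a b (transpose a b i)     ≡⟨ cong (transpose a b) e ⟩
    transpose a b (transpose a b i')    ≡⟨ transpose-involutive a b i' ⟩
    i'                                  ∎
    where open ≡-Reasoning
  surjective : ∀ i' → 1 ≤ i' → i' ≤ k → Σ ℕ λ i → (1 ≤ i × i ≤ k) × transpose a b i ≡ i'
  surjective i' p q = transpose a b i' , range i' p q , transpose-involutive a b i'
  same-parity : ∀ i → 1 ≤ i → i ≤ k → transpose a b i % 2 ≡ i % 2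
  same-parity i _ _ with transpose a b i | transpose-view a b i
  ... | _ | at-a refl = sym ab
  ... | _ | at-b refl = ab
  ... | _ | other _ _ = refl

≤-suc-cases : ∀ {i k} → i ≤ suc k → i ≤ k ⊎ i ≡ suc k
≤-suc-cases {i} {k} h with i ≟ suc k
... | yes e = inj₂ e
... | no ne = inj₁ (≤-pred (≤∧≢⇒< h ne))

extend : ℕ → (ℕ → ℕ) → ℕ → ℕ
extend k f i with i ≟ suc k
... | yes _ = suc k
... | no _  = f i

extend-last : ∀ k f → extend k f (suc k) ≡ suc k
extend-last k f with suc k ≟ suc k
... | yes _ = refl
... | no ne = ⊥-elim (ne refl)

extend-≤ : ∀ {k} f {i} → i ≤ k → extend k f i ≡ f i
extend-≤ {k} f {i} le with i ≟ suc k
... | yes e = ⊥-elim (<⇒≢ (s≤s le) e)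
... | no _  = refl

parityPerm-extend : ∀ {k f} → ParityPerm k f → ParityPerm (suc k) (extend k f)
parityPerm-extend {k} {f} pf = range , injective , surjective , same-parity
  where
  range : ∀ i → 1 ≤ i → i ≤ suc k → 1 ≤ extend k f i × extend k f i ≤ suc k
  range i p q with ≤-suc-cases q
  ... | inj₂ refl rewrite extend-last k f = s≤s z≤n , ≤-refl
  ... | inj₁ le rewrite extend-≤ f le = let (p' , q') = parityPerm-range pf i p le in p' , m≤n⇒m≤1+n q'
  injective : ∀ i i' → 1 ≤ i → i ≤ suc k → 1 ≤ i' → i' ≤ suc k → extend k f i ≡ extend k f i' → i ≡ i'
  injective i i' p q p' q' e with ≤-suc-cases q | ≤-suc-cases q'
  ... | inj₂ refl | inj₂ refl = refl
  ... | inj₂ refl | inj₁ l' rewrite extend-last k f | extend-≤ f l' =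
    ⊥-elim (<⇒≢ (s≤s (proj₂ (parityPerm-range pf i' p' l'))) (sym e))
  ... | inj₁ l | inj₂ refl rewrite extend-last k f | extend-≤ f l =
    ⊥-elim (<⇒≢ (s≤s (proj₂ (parityPerm-range pf i p l))) e)
  ... | inj₁ l | inj₁ l' rewrite extend-≤ f l | extend-≤ f l' = parityPerm-injective pf i i' p l p' l' e
  surjective : ∀ i' → 1 ≤ i' → i' ≤ suc k → Σ ℕ λ i → (1 ≤ i × i ≤ suc k) × extend k f i ≡ i'
  surjective i' p q with ≤-suc-cases q
  ... | inj₂ refl = suc k , (s≤s z≤n , ≤-refl) , extend-last k f
  ... | inj₁ le = let (a , (pa , qa) , ea) = parityPerm-surjective pf i' p le in
    a , (pa , m≤n⇒m≤1+n qa) , trans (extend-≤ f qa) ea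
  same-parity : ∀ i → 1 ≤ i → i ≤ suc k → extend k f i % 2 ≡ i % 2
  same-parity i p q with ≤-suc-cases q
  ... | inj₂ refl rewrite extend-last k f = refl
  ... | inj₁ le rewrite extend-≤ f le = parityPerm-parity pf i p le

-- Sorting within parity classes

Ordered : Bool → ℕ → ℕ → Set
Ordered true  x y = x < y
Ordered false x y = y < x

ordered-trans : ∀ b {x y z} → Ordered b x y → Ordered b y z → Ordered b x z
ordered-trans true  p q = <-trans p q
ordered-trans false p q = <-trans q p

ordered-asym : ∀ b {x y} → Ordered b x y → Ordered b y x → ⊥
ordered-asym true  = <-asym
ordered-asym false = <-asym

ordered-total : ∀ b {x y} → x ≢ y → Ordered b x y ⊎ Ordered b y x
ordered-total b {x} {y} x≢y with <-cmp x y | b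
... | tri< x<y _ _ | true  = inj₁ x<y
... | tri< x<y _ _ | false = inj₂ x<y
... | tri≈ _ x≡y _ | _     = ⊥-elim (x≢y x≡y)
... | tri> _ _ y<x | true  = inj₂ y<x
... | tri> _ _ y<x | false = inj₁ y<x

ordered? : ∀ b x y → Dec (Ordered b x y)
ordered? true  x y = x <? y
ordered? false x y = y <? x

Periodic₂ : {A : Set} → (ℕ → A) → Set
Periodic₂ d = ∀ i → d (2 + i) ≡ d i

periodic₂-%2 : {A : Set} (d : ℕ → A) → Periodic₂ d → ∀ a → d a ≡ d (a % 2)
periodic₂-%2 d p zero = refl
periodic₂-%2 d p (suc zero) = refl
periodic₂-%2 d p (suc (suc a)) = trans (p a) (periodic₂-%2 d p a)

periodic₂-cong : {A : Set} (d : ℕ → A) → Periodic₂ d → ∀ {a b} → a % 2 ≡ b % 2 → d a ≡ d b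
periodic₂-cong d p {a} {b} e = trans (periodic₂-%2 d p a) (trans (cong d e) (sym (periodic₂-%2 d p b)))

InjectiveOn : (ℕ → ℕ) → ℕ → Set
InjectiveOn u q = ∀ k k' → 1 ≤ k → k ≤ q → 1 ≤ k' → k' ≤ q → u k ≡ u k' → k ≡ k'

injectiveOn-≤ : ∀ {u q q'} → q' ≤ q → InjectiveOn u q → InjectiveOn u q'
injectiveOn-≤ le h k k' p r p' r' = h k k' p (≤-trans r le) p' (≤-trans r' le)

Sorted : (ℕ → Bool) → (ℕ → ℕ) → ℕ → Set
Sorted d w N = ∀ i → 1 ≤ i → 2 + i ≤ N → Ordered (d i) (w i) (w (2 + i))

sorted-cong : ∀ {d w w' N} → (∀ i → 1 ≤ i → i ≤ N → w i ≡ w' i) → Sorted d w N → Sorted d w' N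
sorted-cong {d} e s i p le =
  subst₂ (Ordered (d i)) (e i p (≤-trans (m≤n+m i 2) le)) (e (2 + i) (≤-trans p (m≤n+m i 2)) le) (s i p le)

≤-2+-same-parity : ∀ {k q} → k ≤ 2 + q → k % 2 ≡ q % 2 → k ≢ 2 + q → k ≤ q
≤-2+-same-parity {k} {q} le pk ne with ≤-suc-cases le
... | inj₂ e = ⊥-elim (ne e)
... | inj₁ le' with ≤-suc-cases le'
...   | inj₂ refl = ⊥-elim (suc-%2≢ q pk)
...   | inj₁ le'' = le''

ClassExtremum : (ℕ → ℕ) → Bool → ℕ → Set
ClassExtremum u b q = Σ ℕ λ M → (1 ≤ M × M ≤ q) × M % 2 ≡ q % 2 ×
  (∀ k → 1 ≤ k → k ≤ q → k % 2 ≡ q % 2 → k ≢ M → Ordered b (u k) (u M))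

classExtremum : ∀ u b q → 1 ≤ q → InjectiveOn u q → ClassExtremum u b q
classExtremum u b 1 _ _ = 1 , (≤-refl , ≤-refl) , refl , only
  where
  only : ∀ k → 1 ≤ k → k ≤ 1 → k % 2 ≡ 1 → k ≢ 1 → Ordered b (u k) (u 1)
  only 1 _ _ _ ne = ⊥-elim (ne refl)
  only (suc (suc _)) _ (s≤s ()) _ _
classExtremum u b 2 _ _ = 2 , (s≤s z≤n , ≤-refl) , refl , only
  where
  only : ∀ k → 1 ≤ k → k ≤ 2 → k % 2 ≡ 0 → k ≢ 2 → Ordered b (u k) (u 2)
  only 2 _ _ _ ne = ⊥-elim (ne refl)
  only (suc (suc (suc _))) _ (s≤s (s≤s ())) _ _
classExtremum u b (suc (suc (suc q))) _ inj
  with classExtremum u b (suc q) (s≤s z≤n) (injectiveOn-≤ (m≤n+m (suc q) 2) inj)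
... | M , (pM , qM) , parM , hM with ordered? b (u M) (u (3 + q))
...   | yes M<last = 3 + q , (s≤s z≤n , ≤-refl) , refl , last-wins
  where
  last-wins : ∀ k → 1 ≤ k → k ≤ 3 + q → k % 2 ≡ (3 + q) % 2 → k ≢ 3 + q → Ordered b (u k) (u (3 + q))
  last-wins k p le pk ne with k ≟ M
  ... | yes refl = M<last
  ... | no k≢M = ordered-trans b (hM k p (≤-2+-same-parity le pk ne) pk k≢M) M<last
...   | no M≮last = M , (pM , m≤n⇒m≤o+n 2 qM) , parM , M-wins
  where
  last<M : Ordered b (u (3 + q)) (u M)
  last<M with ordered-total b {u M} {u (3 + q)}
                (λ e → <⇒≢ (s≤s (m≤n⇒m≤1+n qM)) (inj M (3 + q) pM (m≤n⇒m≤o+n 2 qM) (s≤s z≤n) ≤-refl e))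
  ... | inj₁ M<last = ⊥-elim (M≮last M<last)
  ... | inj₂ last<M = last<M
  M-wins : ∀ k → 1 ≤ k → k ≤ 3 + q → k % 2 ≡ (3 + q) % 2 → k ≢ M → Ordered b (u k) (u M)
  M-wins k p le pk ne with k ≟ 3 + q
  ... | yes refl = last<M
  ... | no k≢last = hM k p (≤-2+-same-parity le pk k≢last) pk ne

injectiveOn-∘ : ∀ {u σ N} → ParityPerm N σ → InjectiveOn u N → InjectiveOn (λ k → u (σ k)) N
injectiveOn-∘ {σ = σ} pσ inj k k' p r p' r' e =
  let (σp , σr) = parityPerm-range pσ k p r ; (σp' , σr') = parityPerm-range pσ k' p' r' in
  parityPerm-injective pσ k k' p r p' r' (inj (σ k) (σ k') σp σr σp' σr' e)

-- Selection sort: move the extremum of the class of N to position N, then sort [1, N - 1].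
paritySort : ∀ d → Periodic₂ d → ∀ N u → InjectiveOn u N →
             Σ (ℕ → ℕ) λ η → ParityPerm N η × Sorted d (λ i → u (η i)) N
paritySort d dp zero u inj = (λ i → i) , parityPerm-id 0 , λ _ _ ()
paritySort d dp (suc N) u inj = η , parityPerm-∘ ps (parityPerm-extend pη') , sorted
  where
  q = suc N
  E = classExtremum u (d q) q (s≤s z≤n) inj
  M = proj₁ E
  s = transpose M q
  ps : ParityPerm q s
  ps = let ((pM , qM) , parM , _) = proj₂ E in parityPerm-transpose pM qM (s≤s z≤n) ≤-refl parM
  IH = paritySort d dp N (λ k → u (s k)) (injectiveOn-≤ (n≤1+n N) (injectiveOn-∘ ps inj))
  η' = proj₁ IH
  pη' = proj₁ (proj₂ IH)
  η : ℕ → ℕ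
  η i = s (extend N η' i)
  sorted : Sorted d (λ i → u (η i)) q
  sorted i p le with ≤-suc-cases le
  ... | inj₁ le' rewrite extend-≤ η' (≤-trans (m≤n+m i 2) le')
                       | extend-≤ η' le' = proj₂ (proj₂ IH) i p le'
  ... | inj₂ e = subst₂ (Ordered (d i)) (cong u (sym ηi≡k)) (cong u (sym η[2+i]≡M)) k<M
    where
    i≤N : i ≤ N
    i≤N = ≤-trans (n≤1+n i) (≤-reflexive (suc-injective e))
    ri = parityPerm-range pη' i p i≤N
    k = s (η' i)
    ηi≡k : η i ≡ k
    ηi≡k = cong s (extend-≤ η' i≤N)
    η[2+i]≡M : η (2 + i) ≡ M
    η[2+i]≡M = trans (cong η e) (trans (cong s (extend-last N η')) (transpose-right M q))
    k-range = parityPerm-range ps (η' i) (proj₁ ri) (m≤n⇒m≤1+n (proj₂ ri))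
    k-parity : k % 2 ≡ q % 2
    k-parity = trans (parityPerm-parity ps (η' i) (proj₁ ri) (m≤n⇒m≤1+n (proj₂ ri)))
                     (trans (parityPerm-parity pη' i p i≤N) (cong (_% 2) e))
    k≢M : k ≢ M
    k≢M e' = <⇒≢ (s≤s (proj₂ ri))
      (trans (sym (transpose-involutive M q (η' i))) (trans (cong s e') (transpose-left M q)))
    k<M : Ordered (d i) (u k) (u M)
    k<M = subst (λ b → Ordered b (u k) (u M)) (periodic₂-cong d dp (cong (_% 2) (sym e)))
      (proj₂ (proj₂ (proj₂ E)) k (proj₁ k-range) (proj₂ k-range) k-parity k≢M)

sorted-ordered : ∀ {d w N} → Periodic₂ d → Sorted d w N →
                 ∀ k k' → 1 ≤ k → k < k' → k' ≤ N → k % 2 ≡ k' % 2 → Ordered (d k) (w k) (w k')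
sorted-ordered _ _ k (suc zero) 1≤k (s≤s k≤0) _ _ = ⊥-elim (<⇒≢ 1≤k (sym (n≤0⇒n≡0 k≤0)))
sorted-ordered {d} {w} dp s k (suc (suc k'')) p k<k' le pk with ≤-suc-cases (≤-pred k<k')
... | inj₂ refl = ⊥-elim (suc-%2≢ k'' pk)
... | inj₁ k≤k'' with k ≟ k''
...   | yes refl = s k p le
...   | no k≢k'' = ordered-trans (d k)
        (sorted-ordered dp s k k'' p (≤∧≢⇒< k≤k'' k≢k'') (≤-trans (m≤n+m k'' 2) le) pk)
        (subst (λ b → Ordered b (w k'') (w (2 + k''))) (periodic₂-cong d dp (sym pk))
          (s k'' (≤-trans p k≤k'') le))

module _ {d : ℕ → Bool} (dp : Periodic₂ d) {N : ℕ} (v : ℕ → ℕ) where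

  -- If σ and σ' agree below k, then σ⁻¹ (σ' k) ≥ k, and sortedness of v ∘ σ compares v (σ k) with v (σ' k).
  sorted-first-difference : ∀ {σ σ'} → ParityPerm N σ → ParityPerm N σ' → Sorted d (λ i → v (σ i)) N →
    ∀ k → 1 ≤ k → k ≤ N → (∀ {k'} → k' < k → 1 ≤ k' → σ k' ≡ σ' k') →
    σ k ≡ σ' k ⊎ Ordered (d k) (v (σ k)) (v (σ' k))
  sorted-first-difference {σ} {σ'} pσ pσ' s k pk qk agree
    with parityPerm-surjective pσ (σ' k) (proj₁ (parityPerm-range pσ' k pk qk)) (proj₂ (parityPerm-range pσ' k pk qk))
  ... | x , (px , qx) , σx≡σ'k with <-cmp x k
  ...   | tri< x<k _ _ = ⊥-elim (<⇒≢ x<k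
          (parityPerm-injective pσ' x k px (≤-trans (<⇒≤ x<k) qk) pk qk (trans (sym (agree x<k px)) σx≡σ'k)))
  ...   | tri≈ _ refl _ = inj₁ σx≡σ'k
  ...   | tri> _ _ k<x = inj₂ (subst (λ y → Ordered (d k) (v (σ k)) (v y)) σx≡σ'k
          (sorted-ordered dp s k x pk k<x qx
            (trans (sym (parityPerm-parity pσ' k pk qk))
              (trans (cong (_% 2) (sym σx≡σ'k)) (parityPerm-parity pσ x px qx)))))

  sorted-unique : ∀ {σ σ'} → ParityPerm N σ → ParityPerm N σ' →
    Sorted d (λ i → v (σ i)) N → Sorted d (λ i → v (σ' i)) N → ∀ k → 1 ≤ k → k ≤ N → σ k ≡ σ' k
  sorted-unique {σ} {σ'} pσ pσ' s s' = <-rec (λ k → 1 ≤ k → k ≤ N → σ k ≡ σ' k) step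
    where
    step : ∀ k → (∀ {k'} → k' < k → 1 ≤ k' → k' ≤ N → σ k' ≡ σ' k') → 1 ≤ k → k ≤ N → σ k ≡ σ' k
    step k IH pk qk
      with sorted-first-difference pσ pσ' s k pk qk (λ lt p → IH lt p (≤-trans (<⇒≤ lt) qk))
         | sorted-first-difference pσ' pσ s' k pk qk (λ lt p → sym (IH lt p (≤-trans (<⇒≤ lt) qk)))
    ... | inj₁ e | _ = e
    ... | inj₂ _ | inj₁ e = sym e
    ... | inj₂ o | inj₂ o' = ⊥-elim (ordered-asym (d k) o o')

ordered-midpoint : ∀ b {x y e} → x + y ≡ e + e → Ordered b x y → Ordered b x e
ordered-midpoint true  {x} s x<y = x+x<y+y⇒x<y (≤-trans (+-monoʳ-< x x<y) (≤-reflexive s))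
ordered-midpoint false {x} s y<x = x+x<y+y⇒x<y (≤-trans (≤-reflexive (cong suc (sym s))) (+-monoʳ-< x y<x))

ordered-exchange : ∀ b {x x' y y'} → x + x' ≡ y + y' → Ordered b y' x' → Ordered b x y
ordered-exchange true  {x} {x'} {y} {y'} s y'<x' with <-cmp x y
... | tri< x<y _ _ = x<y
... | tri≈ _ refl _ = ⊥-elim (<⇒≢ y'<x' (sym (+-cancelˡ-≡ x x' y' s)))
... | tri> _ _ y<x = ⊥-elim (<⇒≢ (+-mono-< y<x y'<x') (sym s))
ordered-exchange false {x} {x'} {y} {y'} s x'<y' with <-cmp y x
... | tri< y<x _ _ = y<x
... | tri≈ _ refl _ = ⊥-elim (<⇒≢ x'<y' (+-cancelˡ-≡ y x' y' s))
... | tri> _ _ x<y = ⊥-elim (<⇒≢ (+-mono-< x<y x'<y') s)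

-- Symmetric permutations of [1, 2 M0 + 1]

true≢false : true ≢ false
true≢false ()

module Mirror (M0 : ℕ) where

  M : ℕ
  M = 2 * M0 + 1

  centre : ℕ
  centre = suc M0

  mirror : ℕ → ℕ
  mirror i = M + 1 ∸ i

  Lower : ℕ → Set
  Lower i = 1 ≤ i × i ≤ M0

  M+1≡centre+centre : M + 1 ≡ centre + centre
  M+1≡centre+centre = solve 1 (λ x → con 2 :* x :+ con 1 :+ con 1 := (con 1 :+ x) :+ (con 1 :+ x)) refl M0

  ≤M⇒≤M+1 : ∀ {i} → i ≤ M → i ≤ M + 1
  ≤M⇒≤M+1 le = ≤-trans le (m≤m+n M 1)

  centre≤M : centre ≤ M
  centre≤M = ≤-trans (m≤m+n centre M0)
    (≤-reflexive (solve 1 (λ x → (con 1 :+ x) :+ x := con 2 :* x :+ con 1) refl M0))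

  lower⇒≤M : ∀ {i} → i ≤ M0 → i ≤ M
  lower⇒≤M le = ≤-trans (n≤1+n _) (≤-trans (s≤s le) centre≤M)

  lower⇒≤M+1 : ∀ {i} → i ≤ M0 → i ≤ M + 1
  lower⇒≤M+1 le = ≤M⇒≤M+1 (lower⇒≤M le)

  mirror-involutive : ∀ {i} → i ≤ M + 1 → mirror (mirror i) ≡ i
  mirror-involutive le = m∸[m∸n]≡n le

  mirror-injective : ∀ {a b} → a ≤ M + 1 → b ≤ M + 1 → mirror a ≡ mirror b → a ≡ b
  mirror-injective p q e = trans (sym (mirror-involutive p)) (trans (cong mirror e) (mirror-involutive q))

  mirror-centre : mirror centre ≡ centre
  mirror-centre rewrite M+1≡centre+centre = m+n∸m≡n centre centre

  mirror-parity : ∀ {i} → i ≤ M + 1 → mirror i % 2 ≡ i % 2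
  mirror-parity {i} le = even-+⇒%2≡ (mirror i) i
    (trans (cong (_% 2) (m∸n+n≡m le)) (trans (cong (_% 2) M+1≡centre+centre) (x+x-even centre)))

  mirror-suc : ∀ {i} → suc i ≤ M + 1 → mirror i ≡ suc (mirror (suc i))
  mirror-suc le = +-∸-assoc 1 le

  mirror-2+ : ∀ {i} → 2 + i ≤ M + 1 → mirror i ≡ 2 + mirror (2 + i)
  mirror-2+ le = trans (mirror-suc (≤-trans (n≤1+n _) le)) (cong suc (mirror-suc le))

  mirror-M0 : mirror M0 ≡ 2 + M0
  mirror-M0 = trans (cong (_∸ M0) (solve 1 (λ x → con 2 :* x :+ con 1 :+ con 1 := (con 2 :+ x) :+ x) refl M0))
                    (m+n∸n≡m (2 + M0) M0)

  mirror-≤M : ∀ {i} → 1 ≤ i → mirror i ≤ M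
  mirror-≤M p = ≤-trans (∸-monoʳ-≤ (M + 1) p) (≤-reflexive (m+n∸n≡m M 1))

  mirror-≥1 : ∀ {i} → i ≤ M → 1 ≤ mirror i
  mirror-≥1 le = ≤-trans (≤-reflexive (sym (m+n∸m≡n M 1))) (∸-monoʳ-≤ (M + 1) le)

  centre<mirror : ∀ {i} → i ≤ M0 → centre < mirror i
  centre<mirror le = ≤-trans (≤-reflexive (cong suc (sym mirror-centre))) (∸-monoʳ-< (s≤s le) (≤M⇒≤M+1 centre≤M))

  mirror-upper : ∀ {i} → centre < i → i ≤ M + 1 → mirror i ≤ M0
  mirror-upper lt le = ≤-pred (≤-trans (∸-monoʳ-< lt le) (≤-reflexive mirror-centre))

  lower≢centre : ∀ {i} → i ≤ M0 → i ≢ centre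
  lower≢centre le e = 1+n≰n (≤-trans (≤-reflexive (cong suc (sym e))) (s≤s le))

  lower≢mirror : ∀ {i j} → i ≤ M0 → j ≤ M0 → i ≢ mirror j
  lower≢mirror p q e = 1+n≰n (≤-trans (n≤1+n _) (≤-trans (centre<mirror q) (≤-trans (≤-reflexive (sym e)) p)))

  mirror-range : ∀ {i} → 1 ≤ i × i ≤ M → 1 ≤ mirror i × mirror i ≤ M
  mirror-range (p , q) = mirror-≥1 q , mirror-≤M p

  lower-range : ∀ {i} → Lower i → 1 ≤ i × i ≤ M
  lower-range (p , q) = p , lower⇒≤M q

  data Position (i : ℕ) : Set where
    lower  : Lower i → Position i
    middle : i ≡ centre → Position i
    upper  : ∀ {i'} → Lower i' → i ≡ mirror i' → Position i

  position : ∀ i → 1 ≤ i → i ≤ M → Position i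
  position i p q with i ≤? M0 | i ≟ centre
  ... | yes le | _      = lower (p , le)
  ... | no _   | yes e  = middle e
  ... | no gt  | no i≢c = upper (mirror-≥1 q , mirror-upper c<i (≤M⇒≤M+1 q)) (sym (mirror-involutive (≤M⇒≤M+1 q)))
    where
    c<i : centre < i
    c<i = ≤∧≢⇒< (≰⇒> gt) (λ e → i≢c (sym e))

  SymPerm : (ℕ → ℕ) → Set
  SymPerm σ = ParityPerm M σ × (∀ i → 1 ≤ i → i ≤ M → σ (mirror i) ≡ mirror (σ i))

  symPerm-range : ∀ {σ} → SymPerm σ → ∀ {i} → 1 ≤ i × i ≤ M → 1 ≤ σ i × σ i ≤ M
  symPerm-range (pσ , _) (p , q) = parityPerm-range pσ _ p q

  symPerm-id : SymPerm (λ i → i)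
  symPerm-id = parityPerm-id M , λ _ _ _ → refl

  symPerm-∘ : ∀ {f g} → SymPerm f → SymPerm g → SymPerm (λ i → f (g i))
  symPerm-∘ {f} {g} (pf , mf) (pg , mg) = parityPerm-∘ pf pg ,
    λ i p q → let (gp , gq) = parityPerm-range pg i p q in trans (cong f (mg i p q)) (mf (g i) gp gq)

  -- σ centre is its own mirror image, and the only such point is the centre.
  symPerm-centre : ∀ {σ} → SymPerm σ → σ centre ≡ centre
  symPerm-centre {σ} (pσ , mσ) = x+x≡y+y⇒x≡y (σ centre) centre (begin
    σ centre + σ centre          ≡⟨ cong (σ centre +_) σc≡mirror ⟩
    σ centre + mirror (σ centre) ≡⟨ +-comm (σ centre) (mirror (σ centre)) ⟩
    mirror (σ centre) + σ centre ≡⟨ m∸n+n≡m (≤M⇒≤M+1 (proj₂ (parityPerm-range pσ centre (s≤s z≤n) centre≤M))) ⟩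
    M + 1                        ≡⟨ M+1≡centre+centre ⟩
    centre + centre              ∎)
    where
    open ≡-Reasoning
    σc≡mirror : σ centre ≡ mirror (σ centre)
    σc≡mirror = trans (cong σ (sym mirror-centre)) (mσ centre (s≤s z≤n) centre≤M)

  symmetrise : (ℕ → ℕ) → ℕ → ℕ
  symmetrise h i with i ≤? M0
  ... | yes _ = h i
  ... | no _ with i ≟ centre
  ...   | yes _ = i
  ...   | no _  = mirror (h (mirror i))

  symmetrise-lower : ∀ h {i} → i ≤ M0 → symmetrise h i ≡ h i
  symmetrise-lower h {i} le with i ≤? M0
  ... | yes _ = refl
  ... | no gt = ⊥-elim (gt le)

  symmetrise-centre : ∀ h → symmetrise h centre ≡ centre
  symmetrise-centre h with centre ≤? M0
  ... | yes le = ⊥-elim (1+n≰n le)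
  ... | no _ with centre ≟ centre
  ...   | yes _ = refl
  ...   | no c≢c = ⊥-elim (c≢c refl)

  symmetrise-upper : ∀ h {i} → i ≤ M0 → symmetrise h (mirror i) ≡ mirror (h i)
  symmetrise-upper h {i} le with mirror i ≤? M0
  ... | yes le' = ⊥-elim (1+n≰n (≤-trans (centre<mirror le) (≤-trans le' (n≤1+n M0))))
  ... | no _ with mirror i ≟ centre
  ...   | yes e = ⊥-elim (<⇒≢ (centre<mirror le) (sym e))
  ...   | no _  = cong (λ z → mirror (h z)) (mirror-involutive (lower⇒≤M+1 le))

  -- The lower half of a symmetric parity permutation: h picks one point of each mirror pair
  -- {k, mirror k}, k lower, with the parity of its argument.
  record HalfSymPerm (h : ℕ → ℕ) : Set where
    field
      range      : ∀ {i} → Lower i → 1 ≤ h i × h i ≤ M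
      off-centre : ∀ {i} → Lower i → h i ≢ centre
      parity     : ∀ {i} → Lower i → h i % 2 ≡ i % 2
      injective  : ∀ {i i'} → Lower i → Lower i' → h i ≡ h i' → i ≡ i'
      no-mirror  : ∀ {i i'} → Lower i → Lower i' → h i ≢ mirror (h i')
      surjective : ∀ {k} → Lower k → Σ ℕ λ i → Lower i × (h i ≡ k ⊎ h i ≡ mirror k)

  module _ {h : ℕ → ℕ} (ok : HalfSymPerm h) where
    open HalfSymPerm ok

    private
      h≤M+1 : ∀ {i} → Lower i → h i ≤ M + 1
      h≤M+1 l = ≤M⇒≤M+1 (proj₂ (range l))

      h≢mirror-centre : ∀ {i} → Lower i → mirror (h i) ≢ centre
      h≢mirror-centre l e = off-centre l (mirror-injective (h≤M+1 l) (≤M⇒≤M+1 centre≤M) (trans e (sym mirror-centre)))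

    symmetrise-range : ∀ i → 1 ≤ i → i ≤ M → 1 ≤ symmetrise h i × symmetrise h i ≤ M
    symmetrise-range i p q with position i p q
    ... | lower l rewrite symmetrise-lower h (proj₂ l) = range l
    ... | middle refl rewrite symmetrise-centre h = s≤s z≤n , centre≤M
    ... | upper l refl rewrite symmetrise-upper h (proj₂ l) = mirror-range (range l)

    symmetrise-injective : ∀ i i' → 1 ≤ i → i ≤ M → 1 ≤ i' → i' ≤ M → symmetrise h i ≡ symmetrise h i' → i ≡ i'
    symmetrise-injective i i' p q p' q' e with position i p q | position i' p' q'
    ... | lower l | lower l' rewrite symmetrise-lower h (proj₂ l) | symmetrise-lower h (proj₂ l') = injective l l' e
    ... | lower l | middle refl rewrite symmetrise-lower h (proj₂ l) | symmetrise-centre h = ⊥-elim (off-centre l e)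
    ... | lower l | upper l' refl rewrite symmetrise-lower h (proj₂ l) | symmetrise-upper h (proj₂ l') = ⊥-elim (no-mirror l l' e)
    ... | middle refl | lower l' rewrite symmetrise-lower h (proj₂ l') | symmetrise-centre h = ⊥-elim (off-centre l' (sym e))
    ... | middle refl | middle refl = refl
    ... | middle refl | upper l' refl rewrite symmetrise-upper h (proj₂ l') | symmetrise-centre h = ⊥-elim (h≢mirror-centre l' (sym e))
    ... | upper l refl | lower l' rewrite symmetrise-lower h (proj₂ l') | symmetrise-upper h (proj₂ l) = ⊥-elim (no-mirror l' l (sym e))
    ... | upper l refl | middle refl rewrite symmetrise-upper h (proj₂ l) | symmetrise-centre h = ⊥-elim (h≢mirror-centre l e)
    ... | upper l refl | upper l' refl rewrite symmetrise-upper h (proj₂ l) | symmetrise-upper h (proj₂ l') =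
      cong mirror (injective l l' (mirror-injective (h≤M+1 l) (h≤M+1 l') e))

    symmetrise-surjective : ∀ k → 1 ≤ k → k ≤ M → Σ ℕ λ i → (1 ≤ i × i ≤ M) × symmetrise h i ≡ k
    symmetrise-surjective k p q with position k p q
    ... | middle refl = centre , (s≤s z≤n , centre≤M) , symmetrise-centre h
    ... | lower l with surjective l
    ...   | i , li , inj₁ e = i , lower-range li , trans (symmetrise-lower h (proj₂ li)) e
    ...   | i , li , inj₂ e = mirror i , mirror-range (lower-range li) ,
            trans (symmetrise-upper h (proj₂ li)) (trans (cong mirror e) (mirror-involutive (lower⇒≤M+1 (proj₂ l))))
    symmetrise-surjective k p q | upper l refl with surjective l
    ...   | i , li , inj₁ e = mirror i , mirror-range (lower-range li) , trans (symmetrise-upper h (proj₂ li)) (cong mirror e)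
    ...   | i , li , inj₂ e = i , lower-range li , trans (symmetrise-lower h (proj₂ li)) e

    symmetrise-parity : ∀ i → 1 ≤ i → i ≤ M → symmetrise h i % 2 ≡ i % 2
    symmetrise-parity i p q with position i p q
    ... | lower l rewrite symmetrise-lower h (proj₂ l) = parity l
    ... | middle refl rewrite symmetrise-centre h = refl
    ... | upper l refl rewrite symmetrise-upper h (proj₂ l) =
      trans (mirror-parity (h≤M+1 l)) (trans (parity l) (sym (mirror-parity (lower⇒≤M+1 (proj₂ l)))))

    symmetrise-mirror : ∀ i → 1 ≤ i → i ≤ M → symmetrise h (mirror i) ≡ mirror (symmetrise h i)
    symmetrise-mirror i p q with position i p q
    ... | lower l rewrite symmetrise-lower h (proj₂ l) = symmetrise-upper h (proj₂ l)
    ... | middle refl rewrite mirror-centre | symmetrise-centre h = sym mirror-centre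
    ... | upper l refl rewrite symmetrise-upper h (proj₂ l) | mirror-involutive (lower⇒≤M+1 (proj₂ l))
                             | mirror-involutive (h≤M+1 l) = symmetrise-lower h (proj₂ l)

    symPerm-symmetrise : SymPerm (symmetrise h)
    symPerm-symmetrise =
      (symmetrise-range , symmetrise-injective , symmetrise-surjective , symmetrise-parity) , symmetrise-mirror

  halfSymPerm-parityPerm : ∀ {η} → ParityPerm M0 η → HalfSymPerm η
  halfSymPerm-parityPerm {η} pη = record
    { range      = λ (p , q) → lower-range (parityPerm-range pη _ p q)
    ; off-centre = λ (p , q) → lower≢centre (proj₂ (parityPerm-range pη _ p q))
    ; parity     = λ (p , q) → parityPerm-parity pη _ p q
    ; injective  = λ (p , q) (p' , q') → parityPerm-injective pη _ _ p q p' q'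
    ; no-mirror  = λ (p , q) (p' , q') → lower≢mirror (proj₂ (parityPerm-range pη _ p q)) (proj₂ (parityPerm-range pη _ p' q'))
    ; surjective = λ (p , q) → let (i , li , e) = parityPerm-surjective pη _ p q in i , li , inj₁ e
    }

  flipIf : Bool → ℕ → ℕ
  flipIf true  i = mirror i
  flipIf false i = i

  flips : (ℕ → Bool) → ℕ → ℕ
  flips α i = flipIf (α i) i

  halfSymPerm-flips : ∀ α → HalfSymPerm (flips α)
  halfSymPerm-flips α = record
    { range = range ; off-centre = off-centre ; parity = parity
    ; injective = injective ; no-mirror = no-mirror ; surjective = surjective }
    where
    range : ∀ {i} → Lower i → 1 ≤ flips α i × flips α i ≤ M
    range {i} l with α i
    ... | true  = mirror-range (lower-range l)
    ... | false = lower-range l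
    off-centre : ∀ {i} → Lower i → flips α i ≢ centre
    off-centre {i} l with α i
    ... | true  = λ e → <⇒≢ (centre<mirror (proj₂ l)) (sym e)
    ... | false = lower≢centre (proj₂ l)
    parity : ∀ {i} → Lower i → flips α i % 2 ≡ i % 2
    parity {i} l with α i
    ... | true  = mirror-parity (lower⇒≤M+1 (proj₂ l))
    ... | false = refl
    injective : ∀ {i i'} → Lower i → Lower i' → flips α i ≡ flips α i' → i ≡ i'
    injective {i} {i'} l l' e with α i | α i'
    ... | true  | true  = mirror-injective (lower⇒≤M+1 (proj₂ l)) (lower⇒≤M+1 (proj₂ l')) e
    ... | true  | false = ⊥-elim (lower≢mirror (proj₂ l') (proj₂ l) (sym e))
    ... | false | true  = ⊥-elim (lower≢mirror (proj₂ l) (proj₂ l') e)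
    ... | false | false = e
    no-mirror : ∀ {i i'} → Lower i → Lower i' → flips α i ≢ mirror (flips α i')
    no-mirror {i} {i'} l l' e with α i in αi | α i' in αi'
    ... | true  | true  = lower≢mirror (proj₂ l') (proj₂ l)
                            (sym (trans e (mirror-involutive (lower⇒≤M+1 (proj₂ l')))))
    ... | false | false = lower≢mirror (proj₂ l) (proj₂ l') e
    ... | true  | false with mirror-injective (lower⇒≤M+1 (proj₂ l)) (lower⇒≤M+1 (proj₂ l')) e
    ...   | refl = true≢false (trans (sym αi) αi')
    no-mirror {i} {i'} l l' e | false | true with trans e (mirror-involutive (lower⇒≤M+1 (proj₂ l')))
    ...   | refl = true≢false (trans (sym αi') αi)
    surjective : ∀ {k} → Lower k → Σ ℕ λ i → Lower i × (flips α i ≡ k ⊎ flips α i ≡ mirror k)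
    surjective {k} l with α k in αk
    ... | true  = k , l , inj₂ (cong (λ b → flipIf b k) αk)
    ... | false = k , l , inj₁ (cong (λ b → flipIf b k) αk)

module MirrorSorting (M0 : ℕ) where
  open Mirror M0

  MirrorBalanced : (ℕ → ℕ) → Set
  MirrorBalanced w = ∀ {i j} → 1 ≤ i × i ≤ M → 1 ≤ j × j ≤ M → i % 2 ≡ j % 2 →
                     w i + w (mirror i) ≡ w j + w (mirror j)

  module _ {d : ℕ → Bool} (dp : Periodic₂ d) {w : ℕ → ℕ} (balanced : MirrorBalanced w)
           (oriented : ∀ {i} → Lower i → Ordered (d i) (w i) (w (mirror i)))
           (lower-sorted : Sorted d w M0) where

    private
      centre-range : 1 ≤ centre × centre ≤ M
      centre-range = s≤s z≤n , centre≤M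

    sorted-up-to-centre : ∀ i → 1 ≤ i → 2 + i ≤ centre → Ordered (d i) (w i) (w (2 + i))
    sorted-up-to-centre i p le with ≤-suc-cases le
    ... | inj₁ le' = lower-sorted i p le'
    ... | inj₂ e = subst (λ k → Ordered (d i) (w i) (w k)) (sym e) (ordered-midpoint (d i) w-sums (oriented (p , i≤M0)))
      where
      i≤M0 : i ≤ M0
      i≤M0 = ≤-trans (n≤1+n i) (≤-reflexive (suc-injective e))
      w-sums : w i + w (mirror i) ≡ w centre + w centre
      w-sums = trans (balanced (lower-range (p , i≤M0)) centre-range (cong (_% 2) e))
                     (cong (λ k → w centre + w k) mirror-centre)

    -- Positions above the centre are reflected below it, where ordered-exchange transports the comparison.
    sorted-from-lower-half : Sorted d w M
    sorted-from-lower-half i p le with <-cmp (2 + i) centre | <-cmp (2 + i) (suc centre)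
    ... | tri< lt _ _ | _ = sorted-up-to-centre i p (<⇒≤ lt)
    ... | tri≈ _ e _  | _ = sorted-up-to-centre i p (≤-reflexive e)
    ... | tri> _ _ _  | tri≈ _ e _ rewrite suc-injective (suc-injective e) | sym mirror-M0 = oriented (p , ≤-refl)
    ... | tri> _ _ gt | tri< lt _ _ = ⊥-elim (<-irrefl refl (≤-trans gt (≤-pred lt)))
    ... | tri> _ _ _  | tri> _ _ gt = ordered-exchange (d i) w-sums
          (subst₂ (λ b k → Ordered b (w j) (w k)) dj≡di (sym mirror-i≡2+j) (sorted-up-to-centre j (mirror-≥1 le) 2+j≤centre))
      where
      2+i≤M+1 : 2 + i ≤ M + 1
      2+i≤M+1 = ≤M⇒≤M+1 le
      j : ℕ
      j = mirror (2 + i)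
      mirror-i≡2+j : mirror i ≡ 2 + j
      mirror-i≡2+j = mirror-2+ 2+i≤M+1
      2+j≤centre : 2 + j ≤ centre
      2+j≤centre = ≤-trans (≤-reflexive (sym mirror-i≡2+j))
        (≤-trans (∸-monoʳ-≤ (M + 1) (≤-pred (≤-pred gt))) (≤-reflexive mirror-centre))
      dj≡di : d j ≡ d i
      dj≡di = periodic₂-cong d dp (mirror-parity 2+i≤M+1)
      w-sums : w i + w (mirror i) ≡ w (2 + i) + w j
      w-sums = balanced (p , ≤-trans (m≤n+m i 2) le) (≤-trans p (m≤n+m i 2) , le) refl

  -- Flip each mirror pair into the orientation d asks for, then sort the lower half; the upper half follows by symmetry.
  orientAndSort : ∀ {d} → Periodic₂ d → ∀ v → InjectiveOn v M →
    Σ (ℕ → Bool) λ α → Σ (ℕ → ℕ) λ η → ParityPerm M0 η ×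
      (∀ w → (∀ i → 1 ≤ i → i ≤ M → w i ≡ v (symmetrise (flips α) (symmetrise η i))) → MirrorBalanced w → Sorted d w M)
  orientAndSort {d} dp v v-inj = α , η , pη , sorted
    where
    α : ℕ → Bool
    α i = not (does (ordered? (d i) (v i) (v (mirror i))))
    σα = symmetrise (flips α)
    σα-sym = symPerm-symmetrise (halfSymPerm-flips α)
    u : ℕ → ℕ
    u k = v (σα k)
    oriented-flips : ∀ {i} → Lower i → Ordered (d i) (v (flips α i)) (v (mirror (flips α i)))
    oriented-flips {i} (p , q) with ordered? (d i) (v i) (v (mirror i))
    ... | yes ordered = ordered
    ... | no unordered with ordered-total (d i) {v i} {v (mirror i)}
                              (λ e → lower≢mirror q q (v-inj i (mirror i) p (lower⇒≤M q) (mirror-≥1 (lower⇒≤M q)) (mirror-≤M p) e))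
    ...   | inj₁ ordered = ⊥-elim (unordered ordered)
    ...   | inj₂ reversed = subst (λ k → Ordered (d i) (v (mirror i)) (v k)) (sym (mirror-involutive (lower⇒≤M+1 q))) reversed
    oriented-u : ∀ {i} → Lower i → Ordered (d i) (u i) (u (mirror i))
    oriented-u {i} l = subst₂ (λ x y → Ordered (d i) (v x) (v y))
      (sym (symmetrise-lower (flips α) (proj₂ l))) (sym (symmetrise-upper (flips α) (proj₂ l))) (oriented-flips l)
    S = paritySort d dp M0 u (injectiveOn-≤ (lower⇒≤M ≤-refl) (injectiveOn-∘ (proj₁ σα-sym) v-inj))
    η = proj₁ S
    pη = proj₁ (proj₂ S)
    sorted : ∀ w → (∀ i → 1 ≤ i → i ≤ M → w i ≡ v (σα (symmetrise η i))) → MirrorBalanced w → Sorted d w M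
    sorted w w≡ balanced = sorted-from-lower-half dp balanced oriented lower-sorted
      where
      w-lower : ∀ {i} → Lower i → w i ≡ u (η i)
      w-lower (p , q) = trans (w≡ _ p (lower⇒≤M q)) (cong u (symmetrise-lower η q))
      w-upper : ∀ {i} → Lower i → w (mirror i) ≡ u (mirror (η i))
      w-upper (p , q) = trans (w≡ _ (mirror-≥1 (lower⇒≤M q)) (mirror-≤M p)) (cong u (symmetrise-upper η q))
      oriented : ∀ {i} → Lower i → Ordered (d i) (w i) (w (mirror i))
      oriented {i} l@(p , q) = subst₂ (Ordered (d i)) (sym (w-lower l)) (sym (w-upper l))
        (subst (λ b → Ordered b (u (η i)) (u (mirror (η i)))) (periodic₂-cong d dp (parityPerm-parity pη i p q))
          (oriented-u (parityPerm-range pη i p q)))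
      lower-sorted : Sorted d w M0
      lower-sorted i p le = subst₂ (Ordered (d i)) (sym (w-lower (p , ≤-trans (m≤n+m i 2) le))) (sym (w-lower (≤-trans p (m≤n+m i 2) , le)))
        (proj₂ (proj₂ S) i p le)

-- Rearrangements of labelings

module Rearranging (m0 n0 : ℕ) where
  open Grid m0 n0 hiding (ParityPerm)
  module I = Mirror m0
  module J = Mirror n0

  record Rearrangement (X W : Lab) : Set where
    field
      σ : ℕ → ℕ
      τ : ℕ → ℕ
      σ-sym : I.SymPerm σ
      τ-sym : J.SymPerm τ
      eq : ∀ i j → InGrid i j → W i j ≡ X (σ i) (τ j)

    inGrid : ∀ {i j} → InGrid i j → InGrid (σ i) (τ j)
    inGrid (gi , gj) = I.symPerm-range σ-sym gi , J.symPerm-range τ-sym gj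

  open Rearrangement

  rearrangement-refl : ∀ X → Rearrangement X X
  rearrangement-refl X = record
    { σ = λ i → i ; τ = λ j → j ; σ-sym = I.symPerm-id ; τ-sym = J.symPerm-id ; eq = λ _ _ _ → refl }

  rearrangement-trans : ∀ {X W V} → Rearrangement X W → Rearrangement W V → Rearrangement X V
  rearrangement-trans r r' = record
    { σ = λ i → σ r (σ r' i) ; τ = λ j → τ r (τ r' j)
    ; σ-sym = I.symPerm-∘ (σ-sym r) (σ-sym r') ; τ-sym = J.symPerm-∘ (τ-sym r) (τ-sym r')
    ; eq = λ i j g → trans (eq r' i j g) (eq r (σ r' i) (τ r' j) (inGrid r' g)) }

  columnRearrangement : ∀ {X W} (h : ℕ → ℕ) → I.HalfSymPerm h →
    (∀ i j → InGrid i j → W i j ≡ X (I.symmetrise h i) j) → Rearrangement X W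
  columnRearrangement h ok e = record
    { σ = I.symmetrise h ; τ = λ j → j ; σ-sym = I.symPerm-symmetrise ok ; τ-sym = J.symPerm-id ; eq = e }

  rowRearrangement : ∀ {X W} (h : ℕ → ℕ) → J.HalfSymPerm h →
    (∀ i j → InGrid i j → W i j ≡ X i (J.symmetrise h j)) → Rearrangement X W
  rowRearrangement h ok e = record
    { σ = λ i → i ; τ = J.symmetrise h ; σ-sym = I.symPerm-id ; τ-sym = J.symPerm-symmetrise ok ; eq = e }

  opA⇒rearrangement : ∀ {X Z} → OpA X Z → Rearrangement X Z
  opA⇒rearrangement {X} {Z} (η , pη , moved , fixed) = columnRearrangement η (I.halfSymPerm-parityPerm pη) eq'
    where
    eq' : ∀ i j → InGrid i j → Z i j ≡ X (I.symmetrise η i) j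
    eq' i j ((p , q) , (pj , qj)) with I.position i p q
    ... | I.lower (p' , l) = trans (proj₁ (moved i j p' l pj qj)) (cong (λ z → X z j) (sym (I.symmetrise-lower η l)))
    ... | I.middle refl = trans (fixed j pj qj) (cong (λ z → X z j) (sym (I.symmetrise-centre η)))
    ... | I.upper (p' , l) refl = trans (proj₂ (moved _ j p' l pj qj)) (cong (λ z → X z j) (sym (I.symmetrise-upper η l)))

  opB⇒rearrangement : ∀ {X Z} → OpB X Z → Rearrangement X Z
  opB⇒rearrangement {X} {Z} (κ , pκ , moved , fixed) = rowRearrangement κ (J.halfSymPerm-parityPerm pκ) eq'
    where
    eq' : ∀ i j → InGrid i j → Z i j ≡ X i (J.symmetrise κ j)
    eq' i j ((pi , qi) , (p , q)) with J.position j p q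
    ... | J.lower (p' , l) = trans (proj₁ (moved i j pi qi p' l)) (cong (X i) (sym (J.symmetrise-lower κ l)))
    ... | J.middle refl = trans (fixed i pi qi) (cong (X i) (sym (J.symmetrise-centre κ)))
    ... | J.upper (p' , l) refl = trans (proj₂ (moved i _ pi qi p' l)) (cong (X i) (sym (J.symmetrise-upper κ l)))

  opC⇒rearrangement : ∀ {X Z} → OpC X Z → Rearrangement X Z
  opC⇒rearrangement {X} {Z} (α , swapped , fixed) = columnRearrangement (I.flips α) (I.halfSymPerm-flips α) eq'
    where
    pair : ∀ {i j} → I.Lower i → 1 ≤ j → j ≤ n → ∀ b → α i ≡ b →
           Z i j ≡ X (I.flipIf b i) j × Z (I.mirror i) j ≡ X (I.mirror (I.flipIf b i)) j
    pair {i} {j} (p , l) pj qj true  αi = let (z₁ , z₂) = proj₁ (swapped i j p l pj qj) αi in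
      z₁ , trans z₂ (cong (λ k → X k j) (sym (I.mirror-involutive (I.lower⇒≤M+1 l))))
    pair {i} {j} (p , l) pj qj false αi = proj₂ (swapped i j p l pj qj) αi
    eq' : ∀ i j → InGrid i j → Z i j ≡ X (I.symmetrise (I.flips α) i) j
    eq' i j ((p , q) , (pj , qj)) with I.position i p q
    ... | I.lower l = trans (proj₁ (pair l pj qj (α i) refl))
                            (cong (λ z → X z j) (sym (I.symmetrise-lower (I.flips α) (proj₂ l))))
    ... | I.middle refl = trans (fixed j pj qj) (cong (λ z → X z j) (sym (I.symmetrise-centre (I.flips α))))
    ... | I.upper {i'} l refl = trans (proj₂ (pair l pj qj (α i') refl))
                                      (cong (λ z → X z j) (sym (I.symmetrise-upper (I.flips α) (proj₂ l))))

  opD⇒rearrangement : ∀ {X Z} → OpD X Z → Rearrangement X Z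
  opD⇒rearrangement {X} {Z} (δ , swapped , fixed) = rowRearrangement (J.flips δ) (J.halfSymPerm-flips δ) eq'
    where
    pair : ∀ {i j} → 1 ≤ i → i ≤ m → J.Lower j → ∀ b → δ j ≡ b →
           Z i j ≡ X i (J.flipIf b j) × Z i (J.mirror j) ≡ X i (J.mirror (J.flipIf b j))
    pair {i} {j} pi qi (p , l) true  δj = let (z₁ , z₂) = proj₁ (swapped i j pi qi p l) δj in
      z₁ , trans z₂ (cong (X i) (sym (J.mirror-involutive (J.lower⇒≤M+1 l))))
    pair {i} {j} pi qi (p , l) false δj = proj₂ (swapped i j pi qi p l) δj
    eq' : ∀ i j → InGrid i j → Z i j ≡ X i (J.symmetrise (J.flips δ) j)
    eq' i j ((pi , qi) , (p , q)) with J.position j p q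
    ... | J.lower l = trans (proj₁ (pair pi qi l (δ j) refl))
                            (cong (X i) (sym (J.symmetrise-lower (J.flips δ) (proj₂ l))))
    ... | J.middle refl = trans (fixed i pi qi) (cong (X i) (sym (J.symmetrise-centre (J.flips δ))))
    ... | J.upper {j'} l refl = trans (proj₂ (pair pi qi l (δ j') refl))
                                      (cong (X i) (sym (J.symmetrise-upper (J.flips δ) (proj₂ l))))

  step⇒rearrangement : ∀ {X Z} → Step X Z → Rearrangement X Z
  step⇒rearrangement (_ , inj₁ a) = opA⇒rearrangement a
  step⇒rearrangement (_ , inj₂ (inj₁ b)) = opB⇒rearrangement b
  step⇒rearrangement (_ , inj₂ (inj₂ (inj₁ c))) = opC⇒rearrangement c
  step⇒rearrangement (_ , inj₂ (inj₂ (inj₂ d))) = opD⇒rearrangement d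

  steps⇒rearrangement : ∀ {X Z} → Star Step X Z → Rearrangement X Z
  steps⇒rearrangement {X} ε = rearrangement-refl X
  steps⇒rearrangement (s ◅ ss) = rearrangement-trans (step⇒rearrangement s) (steps⇒rearrangement ss)

  symmetrise-opA : ∀ {X η} → ParityPerm m0 η → OpA X (λ i j → X (I.symmetrise η i) j)
  symmetrise-opA {X} {η} pη = η , pη ,
    (λ i j _ l _ _ → cong (λ k → X k j) (I.symmetrise-lower η l) , cong (λ k → X k j) (I.symmetrise-upper η l)) ,
    (λ j _ _ → cong (λ k → X k j) (I.symmetrise-centre η))

  symmetrise-opB : ∀ {X κ} → ParityPerm n0 κ → OpB X (λ i j → X i (J.symmetrise κ j))
  symmetrise-opB {X} {κ} pκ = κ , pκ ,
    (λ i j _ _ _ l → cong (X i) (J.symmetrise-lower κ l) , cong (X i) (J.symmetrise-upper κ l)) ,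
    (λ i _ _ → cong (X i) (J.symmetrise-centre κ))

  symmetrise-opC : ∀ {X} α → OpC X (λ i j → X (I.symmetrise (I.flips α) i) j)
  symmetrise-opC {X} α = α , swapped , (λ j _ _ → cong (λ k → X k j) (I.symmetrise-centre (I.flips α)))
    where
    swapped : ∀ i j → 1 ≤ i → i ≤ m0 → 1 ≤ j → j ≤ n →
      (α i ≡ true → X (I.symmetrise (I.flips α) i) j ≡ X (I.mirror i) j × X (I.symmetrise (I.flips α) (I.mirror i)) j ≡ X i j)
      × (α i ≡ false → X (I.symmetrise (I.flips α) i) j ≡ X i j × X (I.symmetrise (I.flips α) (I.mirror i)) j ≡ X (I.mirror i) j)
    swapped i j _ l _ _ = (λ t → moved (cong (λ b → I.flipIf b i) t) (I.mirror-involutive (I.lower⇒≤M+1 l))) ,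
                          (λ f → moved (cong (λ b → I.flipIf b i) f) refl)
      where
      moved : ∀ {k k'} → I.flips α i ≡ k → I.mirror k ≡ k' →
              X (I.symmetrise (I.flips α) i) j ≡ X k j × X (I.symmetrise (I.flips α) (I.mirror i)) j ≡ X k' j
      moved refl refl = cong (λ k → X k j) (I.symmetrise-lower (I.flips α) l) ,
                        cong (λ k → X k j) (I.symmetrise-upper (I.flips α) l)

  symmetrise-opD : ∀ {X} δ → OpD X (λ i j → X i (J.symmetrise (J.flips δ) j))
  symmetrise-opD {X} δ = δ , swapped , (λ i _ _ → cong (X i) (J.symmetrise-centre (J.flips δ)))
    where
    swapped : ∀ i j → 1 ≤ i → i ≤ m → 1 ≤ j → j ≤ n0 →
      (δ j ≡ true → X i (J.symmetrise (J.flips δ) j) ≡ X i (J.mirror j) × X i (J.symmetrise (J.flips δ) (J.mirror j)) ≡ X i j)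
      × (δ j ≡ false → X i (J.symmetrise (J.flips δ) j) ≡ X i j × X i (J.symmetrise (J.flips δ) (J.mirror j)) ≡ X i (J.mirror j))
    swapped i j _ _ _ l = (λ t → moved (cong (λ b → J.flipIf b j) t) (J.mirror-involutive (J.lower⇒≤M+1 l))) ,
                          (λ f → moved (cong (λ b → J.flipIf b j) f) refl)
      where
      moved : ∀ {k k'} → J.flips δ j ≡ k → J.mirror k ≡ k' →
              X i (J.symmetrise (J.flips δ) j) ≡ X i k × X i (J.symmetrise (J.flips δ) (J.mirror j)) ≡ X i k'
      moved refl refl = cong (X i) (J.symmetrise-lower (J.flips δ) l) , cong (X i) (J.symmetrise-upper (J.flips δ) l)

module Preservation (m0 n0 : ℕ) where
  open Grid m0 n0 hiding (ParityPerm)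
  open Rearranging m0 n0
  open Rearrangement

  InteriorMagic : ℕ → Lab → Set
  InteriorMagic c x = ∀ i j → 1 ≤ i → i ≤ m ∸ 1 → 1 ≤ j → j ≤ n ∸ 1 →
    x i j + x (i + 1) j + x i (j + 1) + x (i + 1) (j + 1) ≡ c

  +1≤⇒≤∸1 : ∀ {k N} → k + 1 ≤ N → k ≤ N ∸ 1
  +1≤⇒≤∸1 {k} le = ≤-trans (≤-reflexive (sym (m+n∸n≡m k 1))) (∸-monoˡ-≤ 1 le)

  ≤∸1⇒+1≤ : ∀ {k N} → 1 ≤ k → k ≤ N ∸ 1 → k + 1 ≤ N
  ≤∸1⇒+1≤ {k} {zero} p q = ⊥-elim (1+n≰n (≤-trans p q))
  ≤∸1⇒+1≤ {k} {suc N} p q = ≤-trans (≤-reflexive (+-comm k 1)) (s≤s q)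

  -- odd-distance-sum twice: for i ↦ X i k + X i (k + 1), then for k ↦ X a k + X a' k.
  interiorMagic-odd-distances : ∀ {c X} → InteriorMagic c X → ∀ {a a' b b'} →
    1 ≤ a × a ≤ m → 1 ≤ a' × a' ≤ m → 1 ≤ b × b ≤ n → 1 ≤ b' × b' ≤ n →
    (a + a') % 2 ≡ 1 → (b + b') % 2 ≡ 1 → X a b + X a' b + X a b' + X a' b' ≡ c
  interiorMagic-odd-distances {c} {X} magic {a} {a'} {b} {b'} (pa , qa) (pa' , qa') (pb , qb) (pb' , qb') oa ob =
    trans (+-assoc (X a b + X a' b) (X a b') (X a' b')) (odd-distance-sum {f = λ k → X a k + X a' k} column-pair b b' pb qb pb' qb' ob)
    where
    column-pair : ∀ k → 1 ≤ k → k + 1 ≤ n → (X a k + X a' k) + (X a (k + 1) + X a' (k + 1)) ≡ c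
    column-pair k pk qk = trans (exchange (X a k) (X a' k) (X a (k + 1)) (X a' (k + 1)))
      (odd-distance-sum {f = λ i → X i k + X i (k + 1)} (λ i pi qi → trans (exchange′ (X i k) (X i (k + 1)) (X (i + 1) k) (X (i + 1) (k + 1)))
                                           (magic i k pi (+1≤⇒≤∸1 qi) pk (+1≤⇒≤∸1 qk)))
        a a' pa qa pa' qa' oa)
      where
      exchange : ∀ p q r s → (p + q) + (r + s) ≡ (p + r) + (q + s)
      exchange = solve 4 (λ p q r s → (p :+ q) :+ (r :+ s) := (p :+ r) :+ (q :+ s)) refl
      exchange′ : ∀ p q r s → (p + q) + (r + s) ≡ p + r + q + s
      exchange′ = solve 4 (λ p q r s → (p :+ q) :+ (r :+ s) := p :+ r :+ q :+ s) refl

  magic : ℕ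
  magic = 2 * (m * n) + 3

  OppositeSum : Lab → ℕ → ℕ → ℕ
  OppositeSum Y i j = Y i j + Y (m + 1 ∸ i) (n + 1 ∸ j)

  -- the doubled opposite sums are mn + 3 and 3mn + 3, which add up to twice the magic value
  balanced-opposite-sums : ∀ {Y} → Balanced Y → ∀ {i j i' j'} → InGrid i j → InGrid i' j' →
    (i + j + (i' + j')) % 2 ≡ 1 → OppositeSum Y i j + OppositeSum Y i' j' ≡ magic
  balanced-opposite-sums {Y} bal {i} {j} {i'} {j'} g g' odd = *-cancelˡ-≡ _ _ 2 (begin
    2 * (OppositeSum Y i j + OppositeSum Y i' j')       ≡⟨ *-distribˡ-+ 2 (OppositeSum Y i j) (OppositeSum Y i' j') ⟩
    2 * OppositeSum Y i j + 2 * OppositeSum Y i' j'     ≡⟨ doubled (odd-+-cases (i + j) (i' + j') odd) ⟩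
    2 * magic                                           ∎)
    where
    open ≡-Reasoning
    doubled : _ → 2 * OppositeSum Y i j + 2 * OppositeSum Y i' j' ≡ 2 * magic
    doubled (inj₁ (e , o)) = trans (cong₂ _+_ (proj₁ (bal i j g) e) (proj₂ (bal i' j' g') o))
      (solve 1 (λ t → t :+ con 3 :+ (con 3 :* t :+ con 3) := con 2 :* (con 2 :* t :+ con 3)) refl (m * n))
    doubled (inj₂ (o , e)) = trans (cong₂ _+_ (proj₂ (bal i j g) o) (proj₁ (bal i' j' g') e))
      (solve 1 (λ t → con 3 :* t :+ con 3 :+ (t :+ con 3) := con 2 :* (con 2 :* t :+ con 3)) refl (m * n))

  +1∸+1 : ∀ a b → a + 1 ∸ (b + 1) ≡ a ∸ b
  +1∸+1 a b rewrite +-comm a 1 | +-comm b 1 = refl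

  1≤m : 1 ≤ m
  1≤m = ≤-trans (s≤s z≤n) I.centre≤M

  1≤n : 1 ≤ n
  1≤n = ≤-trans (s≤s z≤n) J.centre≤M

  regroup : ∀ a b c d → a + b + c + d ≡ (a + c) + (b + d)
  regroup = solve 4 (λ a b c d → a :+ b :+ c :+ d := (a :+ c) :+ (b :+ d)) refl

  -- each twisted face consists of two opposite pairs
  balanced-twisted-row-faces : ∀ {Y} → Balanced Y → ∀ i → 1 ≤ i → i ≤ m ∸ 1 →
    Y i n + Y (i + 1) n + Y (m + 1 ∸ i) 1 + Y (m ∸ i) 1 ≡ magic
  balanced-twisted-row-faces {Y} bal i p q = begin
    Y i n + Y (i + 1) n + Y (m + 1 ∸ i) 1 + Y (m ∸ i) 1
      ≡⟨ regroup (Y i n) (Y (i + 1) n) (Y (m + 1 ∸ i) 1) (Y (m ∸ i) 1) ⟩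
    (Y i n + Y (m + 1 ∸ i) 1) + (Y (i + 1) n + Y (m ∸ i) 1)
      ≡⟨ cong₂ (λ u v → (Y i n + Y (m + 1 ∸ i) u) + (Y (i + 1) n + Y v u)) (sym (m+n∸m≡n n 1)) (sym (+1∸+1 m i)) ⟩
    OppositeSum Y i n + OppositeSum Y (i + 1) n
      ≡⟨ balanced-opposite-sums {Y} bal ((p , ≤-trans (m≤m+n i 1) i+1≤m) , (1≤n , ≤-refl))
                                    ((≤-trans p (m≤m+n i 1) , i+1≤m) , (1≤n , ≤-refl))
                                    (odd-witness (i + n) (solve 2 (λ i n → i :+ n :+ (i :+ con 1 :+ n) := con 1 :+ (i :+ n) :* con 2) refl i n)) ⟩
    magic ∎
    where
    open ≡-Reasoning
    i+1≤m = ≤∸1⇒+1≤ p q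

  balanced-twisted-column-faces : ∀ {Y} → Balanced Y → ∀ j → 1 ≤ j → j ≤ n ∸ 1 →
    Y m j + Y m (j + 1) + Y 1 (n + 1 ∸ j) + Y 1 (n ∸ j) ≡ magic
  balanced-twisted-column-faces {Y} bal j p q = begin
    Y m j + Y m (j + 1) + Y 1 (n + 1 ∸ j) + Y 1 (n ∸ j)
      ≡⟨ regroup (Y m j) (Y m (j + 1)) (Y 1 (n + 1 ∸ j)) (Y 1 (n ∸ j)) ⟩
    (Y m j + Y 1 (n + 1 ∸ j)) + (Y m (j + 1) + Y 1 (n ∸ j))
      ≡⟨ cong₂ (λ u v → (Y m j + Y u (n + 1 ∸ j)) + (Y m (j + 1) + Y u v)) (sym (m+n∸m≡n m 1)) (sym (+1∸+1 n j)) ⟩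
    OppositeSum Y m j + OppositeSum Y m (j + 1)
      ≡⟨ balanced-opposite-sums {Y} bal ((1≤m , ≤-refl) , (p , ≤-trans (m≤m+n j 1) j+1≤n))
                                    ((1≤m , ≤-refl) , (≤-trans p (m≤m+n j 1) , j+1≤n))
                                    (odd-witness (m + j) (solve 2 (λ m j → m :+ j :+ (m :+ (j :+ con 1)) := con 1 :+ (m :+ j) :* con 2) refl m j)) ⟩
    magic ∎
    where
    open ≡-Reasoning
    j+1≤n = ≤∸1⇒+1≤ p q


  module _ {X W : Lab} (r : Rearrangement X W) where

    private
      σp = proj₁ (σ-sym r)
      τp = proj₁ (τ-sym r)

    rearrangement-isLabeling : IsLabeling X → IsLabeling W
    rearrangement-isLabeling (range , injective , surjective) = range′ , injective′ , surjective′
      where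
      range′ : ∀ i j → InGrid i j → 1 ≤ W i j × W i j ≤ m * n
      range′ i j g rewrite eq r i j g = range (σ r i) (τ r j) (inGrid r g)
      injective′ : ∀ i j i' j' → InGrid i j → InGrid i' j' → W i j ≡ W i' j' → i ≡ i' × j ≡ j'
      injective′ i j i' j' g@((pi , qi) , (pj , qj)) g'@((pi' , qi') , (pj' , qj')) e =
        let (σi≡σi' , τj≡τj') = injective _ _ _ _ (inGrid r g) (inGrid r g') (trans (sym (eq r i j g)) (trans e (eq r i' j' g')))
        in parityPerm-injective σp i i' pi qi pi' qi' σi≡σi' , parityPerm-injective τp j j' pj qj pj' qj' τj≡τj'
      surjective′ : ∀ k → 1 ≤ k → k ≤ m * n → Σ ℕ λ i → Σ ℕ λ j → InGrid i j × W i j ≡ k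
      surjective′ k p q =
        let (a , b , ((pa , qa) , (pb , qb)) , e) = surjective k p q
            (i , gi , σi≡a) = parityPerm-surjective σp a pa qa
            (j , gj , τj≡b) = parityPerm-surjective τp b pb qb
        in i , j , (gi , gj) , trans (eq r i j (gi , gj)) (trans (cong₂ X σi≡a τj≡b) e)

    rearrangement-balanced : Balanced X → Balanced W
    rearrangement-balanced bal i j g@((pi , qi) , (pj , qj)) =
      (λ e → subst (λ z → 2 * z ≡ m * n + 3) (sym opposite) (proj₁ (bal _ _ (inGrid r g)) (trans same-parity e))) ,
      (λ o → subst (λ z → 2 * z ≡ 3 * (m * n) + 3) (sym opposite) (proj₂ (bal _ _ (inGrid r g)) (trans same-parity o)))
      where
      same-parity : (σ r i + τ r j) % 2 ≡ (i + j) % 2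
      same-parity = +-%2-cong (σ r i) (τ r j) i j (parityPerm-parity σp i pi qi) (parityPerm-parity τp j pj qj)
      mirror-inGrid : InGrid (m + 1 ∸ i) (n + 1 ∸ j)
      mirror-inGrid = I.mirror-range (pi , qi) , J.mirror-range (pj , qj)
      opposite : OppositeSum W i j ≡ OppositeSum X (σ r i) (τ r j)
      opposite = cong₂ _+_ (eq r i j g)
        (trans (eq r _ _ mirror-inGrid) (cong₂ X (proj₂ (σ-sym r) i pi qi) (proj₂ (τ-sym r) j pj qj)))

    rearrangement-interiorMagic : ∀ {c} → InteriorMagic c X → InteriorMagic c W
    rearrangement-interiorMagic magicX i j pi qi pj qj = trans face-eq
      (interiorMagic-odd-distances {X = X} magicX (inGrid r g₀₀ .proj₁) (inGrid r g₁₁ .proj₁) (inGrid r g₀₀ .proj₂) (inGrid r g₁₁ .proj₂)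
        (trans (+-%2-cong (σ r i) (σ r (i + 1)) i (i + 1) (parityPerm-parity σp i pi qi′) (parityPerm-parity σp (i + 1) pi₁ qi₁)) (+-+1-odd i))
        (trans (+-%2-cong (τ r j) (τ r (j + 1)) j (j + 1) (parityPerm-parity τp j pj qj′) (parityPerm-parity τp (j + 1) pj₁ qj₁)) (+-+1-odd j)))
      where
      qi₁ = ≤∸1⇒+1≤ pi qi
      qj₁ = ≤∸1⇒+1≤ pj qj
      qi′ = ≤-trans (m≤m+n i 1) qi₁
      qj′ = ≤-trans (m≤m+n j 1) qj₁
      pi₁ = ≤-trans pi (m≤m+n i 1)
      pj₁ = ≤-trans pj (m≤m+n j 1)
      g₀₀ : InGrid i j
      g₀₀ = (pi , qi′) , (pj , qj′)
      g₁₀ : InGrid (i + 1) j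
      g₁₀ = (pi₁ , qi₁) , (pj , qj′)
      g₀₁ : InGrid i (j + 1)
      g₀₁ = (pi , qi′) , (pj₁ , qj₁)
      g₁₁ : InGrid (i + 1) (j + 1)
      g₁₁ = (pi₁ , qi₁) , (pj₁ , qj₁)
      face-eq : W i j + W (i + 1) j + W i (j + 1) + W (i + 1) (j + 1)
              ≡ X (σ r i) (τ r j) + X (σ r (i + 1)) (τ r j) + X (σ r i) (τ r (j + 1)) + X (σ r (i + 1)) (τ r (j + 1))
      face-eq = cong₂ _+_ (cong₂ _+_ (cong₂ _+_ (eq r i j g₀₀) (eq r (i + 1) j g₁₀)) (eq r i (j + 1) g₀₁)) (eq r (i + 1) (j + 1) g₁₁)

    rearrangement-bicBal : BicBal X → BicBal W
    rearrangement-bicBal (labX , (magicX , _ , _) , balX) =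
      rearrangement-isLabeling labX ,
      (rearrangement-interiorMagic magicX , balanced-twisted-row-faces {W} balW , balanced-twisted-column-faces {W} balW) ,
      balW
      where
      balW = rearrangement-balanced balX

-- The normal form

evenᵇ : ℕ → Bool
evenᵇ zero = true
evenᵇ (suc zero) = false
evenᵇ (suc (suc k)) = evenᵇ k

evenᵇ-true : ∀ k → IsEven k → evenᵇ k ≡ true
evenᵇ-true zero _ = refl
evenᵇ-true (suc (suc k)) e = evenᵇ-true k e

evenᵇ-false : ∀ k → IsOdd k → evenᵇ k ≡ false
evenᵇ-false (suc zero) _ = refl
evenᵇ-false (suc (suc k)) e = evenᵇ-false k e

evenᵇ-cases : ∀ k → evenᵇ k ≡ true × IsEven k ⊎ evenᵇ k ≡ false × IsOdd k
evenᵇ-cases k with %2-cases k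
... | inj₁ e = inj₁ (evenᵇ-true k e , e)
... | inj₂ o = inj₂ (evenᵇ-false k o , o)

+2≤⇒≤∸2 : ∀ {i N} → 2 + i ≤ N → i ≤ N ∸ 2
+2≤⇒≤∸2 {i} le = ≤-trans (≤-reflexive (sym (m+n∸m≡n 2 i))) (∸-monoˡ-≤ 2 le)

≤∸2⇒+2≤ : ∀ {i N} → 1 ≤ i → i ≤ N ∸ 2 → 2 + i ≤ N
≤∸2⇒+2≤ {N = zero} p q = ⊥-elim (1+n≰n (≤-trans p q))
≤∸2⇒+2≤ {N = suc zero} p q = ⊥-elim (1+n≰n (≤-trans p q))
≤∸2⇒+2≤ {N = suc (suc N)} p q = s≤s (s≤s q)

-- Sorted (evenᵇ ∘ e) w N is the normal-form condition: w increases in steps of two where e is even, decreases where it is odd.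
module _ (e : ℕ → ℕ) (w : ℕ → ℕ) (N : ℕ) where

  IncreasingAtEven DecreasingAtOdd : Set
  IncreasingAtEven = ∀ i → 1 ≤ i → i ≤ N ∸ 2 → IsEven (e i) → w i < w (i + 2)
  DecreasingAtOdd = ∀ i → 1 ≤ i → i ≤ N ∸ 2 → IsOdd (e i) → w i > w (i + 2)

  private
    at : ∀ {b} i → Ordered b (w i) (w (2 + i)) → Ordered b (w i) (w (i + 2))
    at {b} i = subst (λ k → Ordered b (w i) (w k)) (+-comm 2 i)

    from : ∀ {b} i → Ordered b (w i) (w (i + 2)) → Ordered b (w i) (w (2 + i))
    from {b} i = subst (λ k → Ordered b (w i) (w k)) (+-comm i 2)

  sorted⇒increasingAtEven : Sorted (λ i → evenᵇ (e i)) w N → IncreasingAtEven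
  sorted⇒increasingAtEven s i p q ev =
    at {true} i (subst (λ b → Ordered b (w i) (w (2 + i))) (evenᵇ-true (e i) ev) (s i p (≤∸2⇒+2≤ p q)))

  sorted⇒decreasingAtOdd : Sorted (λ i → evenᵇ (e i)) w N → DecreasingAtOdd
  sorted⇒decreasingAtOdd s i p q od =
    at {false} i (subst (λ b → Ordered b (w i) (w (2 + i))) (evenᵇ-false (e i) od) (s i p (≤∸2⇒+2≤ p q)))

  normal⇒sorted : IncreasingAtEven → DecreasingAtOdd → Sorted (λ i → evenᵇ (e i)) w N
  normal⇒sorted inc dec i p le with evenᵇ-cases (e i)
  ... | inj₁ (t , ev) = subst (λ b → Ordered b (w i) (w (2 + i))) (sym t) (from {true} i (inc i p (+2≤⇒≤∸2 le) ev))
  ... | inj₂ (f , od) = subst (λ b → Ordered b (w i) (w (2 + i))) (sym f) (from {false} i (dec i p (+2≤⇒≤∸2 le) od))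

module NormalForm (m0 n0 : ℕ) where
  open Grid m0 n0 hiding (ParityPerm)
  open Rearranging m0 n0
  open Rearrangement
  open Preservation m0 n0

  rowDirection columnDirection : ℕ → Bool
  rowDirection i = evenᵇ (i + suc n0)
  columnDirection j = evenᵇ (suc m0 + j)

  rowDirection-periodic : Periodic₂ rowDirection
  rowDirection-periodic i = refl

  columnDirection-periodic : Periodic₂ columnDirection
  columnDirection-periodic j = cong evenᵇ (trans (+-suc (suc m0) (suc j)) (cong suc (+-suc (suc m0) j)))

  middleRow middleColumn : Lab → ℕ → ℕ
  middleRow Z i = Z i (suc n0)
  middleColumn Z j = Z (suc m0) j

  normal⇒sorted-middleRow : ∀ {Z} → Normal Z → Sorted rowDirection (middleRow Z) m
  normal⇒sorted-middleRow {Z} (inc , dec , _ , _) = normal⇒sorted (λ i → i + suc n0) (middleRow Z) m inc dec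

  normal⇒sorted-middleColumn : ∀ {Z} → Normal Z → Sorted columnDirection (middleColumn Z) n
  normal⇒sorted-middleColumn {Z} (_ , _ , inc , dec) = normal⇒sorted (λ j → suc m0 + j) (middleColumn Z) n inc dec

  sorted⇒normal : ∀ {Z} → Sorted rowDirection (middleRow Z) m → Sorted columnDirection (middleColumn Z) n → Normal Z
  sorted⇒normal {Z} sr sc =
    sorted⇒increasingAtEven (λ i → i + suc n0) (middleRow Z) m sr ,
    sorted⇒decreasingAtOdd (λ i → i + suc n0) (middleRow Z) m sr ,
    sorted⇒increasingAtEven (λ j → suc m0 + j) (middleColumn Z) n sc ,
    sorted⇒decreasingAtOdd (λ j → suc m0 + j) (middleColumn Z) n sc

  balanced-same-class : ∀ {Y} → Balanced Y → ∀ {i j i' j'} → InGrid i j → InGrid i' j' →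
    (i + j) % 2 ≡ (i' + j') % 2 → OppositeSum Y i j ≡ OppositeSum Y i' j'
  balanced-same-class bal {i} {j} g g' same with %2-cases (i + j)
  ... | inj₁ e = *-cancelˡ-≡ _ _ 2 (trans (proj₁ (bal _ _ g) e) (sym (proj₁ (bal _ _ g') (trans (sym same) e))))
  ... | inj₂ o = *-cancelˡ-≡ _ _ 2 (trans (proj₂ (bal _ _ g) o) (sym (proj₂ (bal _ _ g') (trans (sym same) o))))

  balanced-middleRow : ∀ {Y} → Balanced Y → MirrorSorting.MirrorBalanced m0 (middleRow Y)
  balanced-middleRow {Y} bal {i} {i'} gi gi' same =
    subst₂ (λ k k' → Y i (suc n0) + Y (I.mirror i) k ≡ Y i' (suc n0) + Y (I.mirror i') k') J.mirror-centre J.mirror-centre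
      (balanced-same-class {Y} bal (gi , c) (gi' , c) (+-%2-cong i (suc n0) i' (suc n0) same refl))
    where c = s≤s z≤n , J.centre≤M

  balanced-middleColumn : ∀ {Y} → Balanced Y → MirrorSorting.MirrorBalanced n0 (middleColumn Y)
  balanced-middleColumn {Y} bal {j} {j'} gj gj' same =
    subst₂ (λ k k' → Y (suc m0) j + Y k (J.mirror j) ≡ Y (suc m0) j' + Y k' (J.mirror j')) I.mirror-centre I.mirror-centre
      (balanced-same-class {Y} bal (c , gj) (c , gj') (+-%2-cong (suc m0) j (suc m0) j' refl same))
    where c = s≤s z≤n , I.centre≤M

  middleRow-injective : ∀ {Y} → IsLabeling Y → InjectiveOn (middleRow Y) m
  middleRow-injective (_ , inj , _) k k' p q p' q' e = proj₁ (inj k _ k' _ ((p , q) , c) ((p' , q') , c) e)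
    where c = s≤s z≤n , J.centre≤M

  middleColumn-injective : ∀ {Y} → IsLabeling Y → InjectiveOn (middleColumn Y) n
  middleColumn-injective (_ , inj , _) k k' p q p' q' e = proj₂ (inj _ k _ k' (c , (p , q)) (c , (p' , q')) e)
    where c = s≤s z≤n , I.centre≤M

  rearrangement-middleRow : ∀ {Y A} (r : Rearrangement Y A) → ∀ i → 1 ≤ i → i ≤ m → middleRow A i ≡ middleRow Y (σ r i)
  rearrangement-middleRow {Y} r i p q = trans (eq r i _ ((p , q) , (s≤s z≤n , J.centre≤M))) (cong (Y (σ r i)) (J.symPerm-centre (τ-sym r)))

  rearrangement-middleColumn : ∀ {Y A} (r : Rearrangement Y A) → ∀ j → 1 ≤ j → j ≤ n → middleColumn A j ≡ middleColumn Y (τ r j)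
  rearrangement-middleColumn {Y} r j p q = trans (eq r _ j ((s≤s z≤n , I.centre≤M) , (p , q))) (cong (λ k → Y k (τ r j)) (I.symPerm-centre (σ-sym r)))

  normal-unique : ∀ {Y A B} → Rearrangement Y A → Rearrangement Y B → Normal A → Normal B → ∀ i j → InGrid i j → A i j ≡ B i j
  normal-unique {Y} {A} {B} rA rB nA nB i j g@((pi , qi) , (pj , qj)) = begin
    A i j                ≡⟨ eq rA i j g ⟩
    Y (σ rA i) (τ rA j)  ≡⟨ cong₂ Y (same-σ i pi qi) (same-τ j pj qj) ⟩
    Y (σ rB i) (τ rB j)  ≡⟨ eq rB i j g ⟨
    B i j                ∎
    where
    open ≡-Reasoning
    same-σ : ∀ k → 1 ≤ k → k ≤ m → σ rA k ≡ σ rB k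
    same-σ = sorted-unique rowDirection-periodic (middleRow Y) (proj₁ (σ-sym rA)) (proj₁ (σ-sym rB))
      (sorted-cong (rearrangement-middleRow rA) (normal⇒sorted-middleRow {A} nA))
      (sorted-cong (rearrangement-middleRow rB) (normal⇒sorted-middleRow {B} nB))
    same-τ : ∀ k → 1 ≤ k → k ≤ n → τ rA k ≡ τ rB k
    same-τ = sorted-unique columnDirection-periodic (middleColumn Y) (proj₁ (τ-sym rA)) (proj₁ (τ-sym rB))
      (sorted-cong (rearrangement-middleColumn rA) (normal⇒sorted-middleColumn {A} nA))
      (sorted-cong (rearrangement-middleColumn rB) (normal⇒sorted-middleColumn {B} nB))

  -- Orient and sort the middle row by operations (c) and (a), then the middle column by (d) and (b);
  -- the latter two fix the index suc n0, hence the middle row.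
  normalForm-exists : ∀ {X} → BicBal X → Σ Lab λ Z → BicBal Z × Star Step X Z × Normal Z
  normalForm-exists {X} bX = Z , bZ , stepC ◅ stepA ◅ stepD ◅ stepB ◅ ε , sorted⇒normal {Z} rowZ colZ
    where
    row = MirrorSorting.orientAndSort m0 rowDirection-periodic (middleRow X) (middleRow-injective (proj₁ bX))
    α = proj₁ row
    η = proj₁ (proj₂ row)
    Y₁ Y₂ Y₃ Z : Lab
    Y₁ i j = X (I.symmetrise (I.flips α) i) j
    Y₂ i j = Y₁ (I.symmetrise η i) j
    stepC : Step X Y₁
    stepC = bX , inj₂ (inj₂ (inj₁ (symmetrise-opC {X} α)))
    b₁ : BicBal Y₁
    b₁ = rearrangement-bicBal (step⇒rearrangement stepC) bX
    stepA : Step Y₁ Y₂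
    stepA = b₁ , inj₁ (symmetrise-opA {Y₁} (proj₁ (proj₂ (proj₂ row))))
    b₂ : BicBal Y₂
    b₂ = rearrangement-bicBal (step⇒rearrangement stepA) b₁
    column = MirrorSorting.orientAndSort n0 columnDirection-periodic (middleColumn Y₂) (middleColumn-injective (proj₁ b₂))
    δ = proj₁ column
    κ = proj₁ (proj₂ column)
    Y₃ i j = Y₂ i (J.symmetrise (J.flips δ) j)
    Z i j = Y₃ i (J.symmetrise κ j)
    stepD : Step Y₂ Y₃
    stepD = b₂ , inj₂ (inj₂ (inj₂ (symmetrise-opD {Y₂} δ)))
    b₃ : BicBal Y₃
    b₃ = rearrangement-bicBal (step⇒rearrangement stepD) b₂
    stepB : Step Y₃ Z
    stepB = b₃ , inj₂ (inj₁ (symmetrise-opB {Y₃} (proj₁ (proj₂ (proj₂ column)))))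
    bZ : BicBal Z
    bZ = rearrangement-bicBal (step⇒rearrangement stepB) b₃
    rowZ : Sorted rowDirection (middleRow Z) m
    rowZ = proj₂ (proj₂ (proj₂ row)) (middleRow Z)
      (λ i _ _ → cong (Y₂ i) (trans (cong (J.symmetrise (J.flips δ)) (J.symmetrise-centre κ)) (J.symmetrise-centre (J.flips δ))))
      (balanced-middleRow {Z} (proj₂ (proj₂ bZ)))
    colZ : Sorted columnDirection (middleColumn Z) n
    colZ = proj₂ (proj₂ (proj₂ column)) (middleColumn Z) (λ _ _ _ → refl) (balanced-middleColumn {Z} (proj₂ (proj₂ bZ)))

theorem29 : (m0 n0 : ℕ) → 1 ≤ m0 → 1 ≤ n0 → (X : Lab) → Grid.BicBal m0 n0 X →
    Σ Lab λ Z → (Grid.BicBal m0 n0 Z × Grid.Equiv m0 n0 X Z × Grid.Normal m0 n0 Z)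
      × ((Z' : Lab) → Grid.BicBal m0 n0 Z' → Grid.Equiv m0 n0 X Z' → Grid.Normal m0 n0 Z' →
           ∀ i j → Grid.InGrid m0 n0 i j → Z' i j ≡ Z i j)
theorem29 m0 n0 _ _ X bX = Z , (bZ , inj₁ X⇝Z , nZ) , unique
  where
  open Rearranging m0 n0
  E = NormalForm.normalForm-exists m0 n0 {X} bX
  Z : Lab
  Z = proj₁ E
  bZ : Grid.BicBal m0 n0 Z
  bZ = proj₁ (proj₂ E)
  X⇝Z : Star (Grid.Step m0 n0) X Z
  X⇝Z = proj₁ (proj₂ (proj₂ E))
  nZ : Grid.Normal m0 n0 Z
  nZ = proj₂ (proj₂ (proj₂ E))
  unique : (Z' : Lab) → Grid.BicBal m0 n0 Z' → Grid.Equiv m0 n0 X Z' → Grid.Normal m0 n0 Z' →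
           ∀ i j → Grid.InGrid m0 n0 i j → Z' i j ≡ Z i j
  unique Z' _ (inj₁ X⇝Z') nZ' = NormalForm.normal-unique m0 n0 (steps⇒rearrangement X⇝Z') (steps⇒rearrangement X⇝Z) nZ' nZ
  unique Z' _ (inj₂ Z'⇝X) nZ' = NormalForm.normal-unique m0 n0
    (rearrangement-refl Z') (rearrangement-trans (steps⇒rearrangement Z'⇝X) (steps⇒rearrangement X⇝Z)) nZ' nZ
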